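{- The family $\mathbf{Gr}=(\mathbf{Gr}(k,l))_{k,l\ge 0}$ of vector spaces spanned by isomorphism classes of graphs, equipped with the actions of the symmetric groups, the horizontal concatenation $*$ and the vertical concatenation $\circ$ described below (extended bilinearly), is a ProP, with units $I_0$ (the empty graph) and $I_1$ (the graph consisting of a single input-output edge).
   Context: Vector spaces are over $\mathbb K\in\{\mathbb R,\mathbb C\}$, and $[n]=\{1,\dots,n\}$, $[0]=\emptyset$. Graphs. A graph is a tuple $G=(V(G),E(G),I(G),O(G),IO(G),L(G),s,t,\alpha,\beta)$ where $V(G)$ (vertices), $E(G)$ (internal edges), $I(G)$ (input edges), $O(G)$ (output edges), $IO(G)$ (input-output edges), $L(G)$ (loops) are finite sets, $s:E(G)\sqcup O(G)\to V(G)$ (source), $t:E(G)\sqcup I(G)\to V(G)$ (target), $\alpha:I(G)\sqcup IO(G)\to[i(G)]$ is a bijection with $i(G)=|I(G)|+|IO(G)|$, and $\beta:O(G)\sqcup IO(G)\to[o(G)]$ is a bijection with $o(G)=|O(G)|+|IO(G)|$. An isomorphism of graphs is a family of bijections between the six corresponding sets commuting with source and target maps and preserving $\alpha$ and $\beta$. $\mathbf{Gr}(k,l)$ is the vector space with basis the isomorphism classes of graphs with $i(G)=k$, $o(G)=l$. Structure. For $\sigma\in\mathfrak S_{o(G)}$, $\tau\in\mathfrak S_{i(G)}$: $\sigma\cdot G$ is $G$ with $\beta$ replaced by $\sigma\circ\beta$, and $G\cdot\tau$ is $G$ with $\alpha$ replaced by $\tau^{ -1}\circ\alpha$. Horizontal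 concatenation $G*G'$: each of the six sets is the disjoint union of those of $G$ and $G'$, source and target maps restrict to those of $G$ and $G'$, input and output edges of $G$ keep their indices, and those of $G'$ get indices $i(G)+\alpha'$ and $o(G)+\beta'$. Vertical concatenation, for $o(G)=i(G')$ (maps of $G'$ are primed): $G'\circ G$ has $V=V(G)\sqcup V(G')$, $L=L(G)\sqcup L(G')$, $E=E(G)\sqcup E(G')\sqcup\{(f,e)\in O(G)\times I(G'):\beta(f)=\alpha'(e)\}$, $I=I(G)\sqcup\{(f,e)\in IO(G)\times I(G'):\beta(f)=\alpha'(e)\}$, $O=O(G')\sqcup\{(f,e)\in O(G)\times IO(G'):\beta(f)=\alpha'(e)\}$, $IO=\{(f,e)\in IO(G)\times IO(G'):\beta(f)=\alpha'(e)\}$; old edges keep their sources and targets, a new pair $(f,e)$ has source $s(f)$ (when $f\in O(G)$) and target $t'(e)$ (when $e\in I(G')$); input indices are $\alpha$ on $I(G)$ and $\alpha(f)$ on a pair $(f,e)$; output indices are $\beta'$ on $O(G')$ and $\beta'(e)$ on a pair $(f,e)$. ProP. A ProP is a family $P=(P(k,l))_{k,l\ge0}$ of vector spaces such that: (i) each $P(k,l)$ carries a left $\mathfrak S_l$-action $\sigma\cdot p$ and a right $\mathfrak S_k$-action $p\cdot\tau$ which commute; (ii) there are linear maps $*:P(k,l)\otimes P(k',l')\to P(k+k',l+l')$, associative, with a unit $I_0\in P(0,0)$; (iii) there are linear maps $\circ:P(l,m)\otimes P(k,l)\to P(k,m)$, associative, with $I_1\in P(1,1)$ such that $p\circ I_k=I_l\circ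 p=p$ for $p\in P(k,l)$, where $I_n=I_1^{*n}$, $I_1^{*0}=I_0$; (iv) $(p*p')\circ(q*q')=(p\circ q)*(p'\circ q')$; (v) $\sigma\cdot(p\circ q)=(\sigma\cdot p)\circ q$, $(p\circ q)\cdot\nu=p\circ(q\cdot\nu)$, $(p\cdot\tau)\circ q=p\circ(\tau\cdot q)$; (vi) $(\sigma\cdot p)*(\sigma'\cdot p')=(\sigma\otimes\sigma')\cdot(p*p')$, $(p\cdot\tau)*(p'\cdot\tau')=(p*p')\cdot(\tau\otimes\tau')$, and $c_{l,l'}\cdot(p*p')=(p'*p)\cdot c_{k,k'}$ for $p\in P(k,l)$, $p'\in P(k',l')$. Here for $\alpha\in\mathfrak S_m$, $\beta\in\mathfrak S_n$, $\alpha\otimes\beta\in\mathfrak S_{m+n}$ is $\alpha$ on $[m]$ and $i\mapsto\beta(i-m)+m$ for $i>m$; $c_{m,n}\in\mathfrak S_{m+n}$ is $c_{m,n}(i)=i+n$ for $i\le m$ and $c_{m,n}(i)=i-m$ for $i>m$. -}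

module Defs where

open import Level using (Level; _⊔_; 0ℓ) renaming (suc to lsuc)
open import Data.Empty using (⊥)
open import Data.Unit using (⊤; tt)
open import Data.Nat using (ℕ; zero; suc; _+_)
open import Data.Nat.Properties using (+-assoc; +-identityʳ; +-comm)
open import Data.Fin using (Fin; splitAt; join; cast)
open import Data.Fin.Properties using (+↔⊎; _≟_; cast-involutive)
open import Data.Fin.Permutation using (Permutation′; _⟨$⟩ʳ_; _∘ₚ_) renaming (id to idₚ)
open import Data.Sum using (_⊎_; inj₁; inj₂; [_,_]; swap)
import Data.Sum as Sum
open import Data.Sum.Properties using (inj₁-injective; inj₂-injective)
open import Data.Sum.Function.Propositional using (_⊎-↔_)
open import Data.Sum.Algebra using (⊎-comm)
open import Data.Product using (Σ; _×_; _,_; proj₁; proj₂; ∃)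
open import Data.List using (List; []; _∷_; _++_; map; concatMap; allFin)
open import Data.List.Membership.Propositional using (_∈_)
open import Data.List.Membership.Propositional.Properties using (∈-map⁺; ∈-allFin; ∈-++⁺ˡ; ∈-++⁺ʳ)
open import Data.List.Relation.Unary.Any using (here; there)
open import Function.Bundles using (_↔_; Inverse; mk↔ₛ′; _⤖_; mk⤖)
open import Function.Properties.Bijection using (⤖⇒↔)
open import Function.Properties.Inverse using (↔-sym)
open import Function.Construct.Composition using (_↔-∘_)
open import Relation.Nullary using (¬_; yes; no)
open import Relation.Nullary.Decidable using (recompute)
open import Relation.Binary using (Rel)
open import Relation.Binary.PropositionalEquality
  using (_≡_; refl; sym; trans; cong; subst₂)
open import Algebra.Bundles using (CommutativeRing)
open import Algebra.Module.Structures using (IsModule)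

-- Fields (the paper works over K ∈ {ℝ, ℂ}; stdlib has neither, so we
-- work over an arbitrary field, given as a commutative ring in which
-- 1 ≠ 0 and every nonzero element is invertible).

record Field (c ℓ : Level) : Set (lsuc (c ⊔ ℓ)) where
  field
    commutativeRing : CommutativeRing c ℓ
  open CommutativeRing commutativeRing
  field
    1≉0     : ¬ (1# ≈ 0#)
    inverse : ∀ x → ¬ (x ≈ 0#) → ∃ λ y → (x * y) ≈ 1#

-- Finiteness of a type: it can be listed exhaustively.

Listable : Set → Set
Listable A = Σ (List A) λ xs → ∀ x → x ∈ xs

private
  variable
    A B C D : Set
    k l m n k' l' : ℕ

to : A ↔ B → A → B
to = Inverse.to

from : A ↔ B → B → A
from = Inverse.from

-- Graphs (the six sets are arbitrary types; V, E, L are required to be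
-- finite, and I, O, IO are finite because of the bijections α, β).
-- Indices [n] = {1..n} are represented by Fin n = {0..n-1}.

record Graph (k l : ℕ) : Set₁ where
  field
    V E I O IO L : Set
    V-fin : Listable V
    E-fin : Listable E
    L-fin : Listable L
    s : E ⊎ O → V
    t : E ⊎ I → V
    α : (I ⊎ IO) ↔ Fin k
    β : (O ⊎ IO) ↔ Fin l

record _≅_ (G H : Graph k l) : Set where
  private
    module G = Graph G
    module H = Graph H
  field
    φV  : G.V  ↔ H.V
    φE  : G.E  ↔ H.E
    φI  : G.I  ↔ H.I
    φO  : G.O  ↔ H.O
    φIO : G.IO ↔ H.IO
    φL  : G.L  ↔ H.L
    s-comm : ∀ x → H.s (Sum.map (to φE) (to φO) x) ≡ to φV (G.s x)
    t-comm : ∀ x → H.t (Sum.map (to φE) (to φI) x) ≡ to φV (G.t x)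
    α-comm : ∀ x → to H.α (Sum.map (to φI) (to φIO) x) ≡ to G.α x
    β-comm : ∀ x → to H.β (Sum.map (to φO) (to φIO) x) ≡ to G.β x

_·G_ : Permutation′ l → Graph k l → Graph k l
σ ·G G = record G { β = σ ↔-∘ Graph.β G }

_G·_ : Graph k l → Permutation′ k → Graph k l
G G· τ = record G { α = ↔-sym τ ↔-∘ Graph.α G }

listable-⊥ : Listable ⊥
listable-⊥ = [] , λ ()

listable-⊎ : Listable A → Listable B → Listable (A ⊎ B)
listable-⊎ (xs , p) (ys , q) =
  map inj₁ xs ++ map inj₂ ys ,
  λ { (inj₁ a) → ∈-++⁺ˡ (∈-map⁺ inj₁ (p a))
    ; (inj₂ b) → ∈-++⁺ʳ (map inj₁ xs) (∈-map⁺ inj₂ (q b)) }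

lefts : List (A ⊎ B) → List A
lefts [] = []
lefts (inj₁ a ∷ xs) = a ∷ lefts xs
lefts (inj₂ _ ∷ xs) = lefts xs

∈-lefts : ∀ {a : A} {xs : List (A ⊎ B)} → inj₁ {B = B} a ∈ xs → a ∈ lefts xs
∈-lefts {xs = inj₁ _ ∷ xs} (here refl) = here refl
∈-lefts {xs = inj₁ _ ∷ xs} (there p) = there (∈-lefts p)
∈-lefts {xs = inj₂ _ ∷ xs} (there p) = ∈-lefts p

listable-Fin↔ : (A ⊎ B) ↔ Fin n → Listable A
listable-Fin↔ {n = n} e =
  lefts (map (from e) (allFin n)) ,
  λ a → ∈-lefts (subst∈ (Inverse.strictlyInverseʳ e (inj₁ a))
                        (∈-map⁺ (from e) (∈-allFin (to e (inj₁ a)))))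
  where
  subst∈ : ∀ {x y : _} {xs : List _} → x ≡ y → x ∈ xs → y ∈ xs
  subst∈ refl p = p

record Match {X Y : Set} {n : ℕ} (f : X → Fin n) (g : Y → Fin n) : Set where
  constructor match
  field
    fst : X
    snd : Y
    .eq : f fst ≡ g snd

module _ {X Y : Set} {n : ℕ} {f : X → Fin n} {g : Y → Fin n} where

  match-≡ : ∀ {x x' y y'} .{p : f x ≡ g y} .{q : f x' ≡ g y'} →
            x ≡ x' → y ≡ y' → match {f = f} {g = g} x y p ≡ match x' y' q
  match-≡ refl refl = refl

  pairsWith : X → List Y → List (Match f g)
  pairsWith x [] = []
  pairsWith x (y ∷ ys) with f x ≟ g y
  ... | yes p = match x y p ∷ pairsWith x ys
  ... | no _  = pairsWith x ys

  ∈-pairsWith : ∀ {x y ys} .(p : f x ≡ g y) → y ∈ ys → match x y p ∈ pairsWith x ys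
  ∈-pairsWith {x} {y} {y' ∷ ys} p (here refl) with f x ≟ g y
  ... | yes _ = here refl
  ... | no ¬p = Data.Empty.⊥-elim (¬p (recompute (f x ≟ g y) p))
    where import Data.Empty
  ∈-pairsWith {x} {y} {y' ∷ ys} p (there q) with f x ≟ g y'
  ... | yes _ = there (∈-pairsWith p q)
  ... | no _  = ∈-pairsWith p q

  allMatches : List X → List Y → List (Match f g)
  allMatches [] ys = []
  allMatches (x ∷ xs) ys = pairsWith x ys ++ allMatches xs ys

  ∈-allMatches : ∀ {x y xs ys} .(p : f x ≡ g y) → x ∈ xs → y ∈ ys →
                 match x y p ∈ allMatches xs ys
  ∈-allMatches {xs = _ ∷ xs} p (here refl) q = ∈-++⁺ˡ (∈-pairsWith p q)
  ∈-allMatches {xs = x' ∷ xs} {ys} p (there r) q =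
    ∈-++⁺ʳ (pairsWith x' ys) (∈-allMatches p r q)

  listable-Match : Listable X → Listable Y → Listable (Match f g)
  listable-Match (xs , px) (ys , py) =
    allMatches xs ys , λ { (match x y p) → ∈-allMatches p (px x) (py y) }

flipMatch : {f : A → Fin n} {g : B → Fin n} → Match f g ↔ Match g f
flipMatch = mk↔ₛ′ (λ { (match a b p) → match b a (sym p) })
                  (λ { (match b a p) → match a b (sym p) })
                  (λ _ → refl) (λ _ → refl)

module Glue {X Y P Q : Set} {k l : ℕ}
            (a : (X ⊎ Y) ↔ Fin k) (c : (P ⊎ Q) ↔ Fin l)
            (g : Y → Fin l) (g-inj : ∀ {y y'} → g y ≡ g y' → y ≡ y') where

  M₁ = Match g (λ p → to c (inj₁ p))
  M₂ = Match g (λ q → to c (inj₂ q))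
  Dom = (X ⊎ M₁) ⊎ M₂

  π : Dom → X ⊎ Y
  π (inj₁ (inj₁ x)) = inj₁ x
  π (inj₁ (inj₂ (match y _ _))) = inj₂ y
  π (inj₂ (match y _ _)) = inj₂ y

  glue-to : Dom → Fin k
  glue-to d = to a (π d)

  private
    c-inj : ∀ {u v} → to c u ≡ to c v → u ≡ v
    c-inj {u} {v} e = trans (sym (Inverse.strictlyInverseʳ c u))
                       (trans (cong (from c) e) (Inverse.strictlyInverseʳ c v))
    a-inj : ∀ {u v} → to a u ≡ to a v → u ≡ v
    a-inj {u} {v} e = trans (sym (Inverse.strictlyInverseʳ a u))
                       (trans (cong (from a) e) (Inverse.strictlyInverseʳ a v))

    bad : ∀ {p q} → to c (inj₁ p) ≡ to c (inj₂ q) → Data.Empty.⊥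
    bad e with c-inj e
    ... | ()
      where import Data.Empty

    π-inj : ∀ {d d'} → π d ≡ π d' → d ≡ d'
    π-inj {inj₁ (inj₁ x)} {inj₁ (inj₁ .x)} refl = refl
    π-inj {inj₁ (inj₂ (match y p e))} {inj₁ (inj₂ (match .y p' e'))} refl =
      cong (λ z → inj₁ (inj₂ z))
        (match-≡ refl (inj₁-injective (c-inj (trans (sym (recompute (g y ≟ _) e))
                                                    (recompute (g y ≟ _) e')))))
    π-inj {inj₁ (inj₂ (match y p e))} {inj₂ (match .y q e')} refl =
      Data.Empty.⊥-elim (bad (trans (sym (recompute (g y ≟ _) e)) (recompute (g y ≟ _) e')))
      where import Data.Empty
    π-inj {inj₂ (match y q e)} {inj₁ (inj₂ (match .y p e'))} refl =
      Data.Empty.⊥-elim (bad (trans (sym (recompute (g y ≟ _) e')) (recompute (g y ≟ _) e)))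
      where import Data.Empty
    π-inj {inj₂ (match y q e)} {inj₂ (match .y q' e')} refl =
      cong inj₂
        (match-≡ refl (inj₂-injective (c-inj (trans (sym (recompute (g y ≟ _) e))
                                                    (recompute (g y ≟ _) e')))))

    fromY' : (y : Y) (w : P ⊎ Q) → from c (g y) ≡ w → Dom
    fromY' y (inj₁ p) eq₀ = inj₁ (inj₂ (match y p
                      (trans (sym (Inverse.strictlyInverseˡ c (g y))) (cong (to c) eq₀))))
    fromY' y (inj₂ q) eq₀ = inj₂ (match y q
                      (trans (sym (Inverse.strictlyInverseˡ c (g y))) (cong (to c) eq₀)))

    fromY : Y → Dom
    fromY y = fromY' y (from c (g y)) refl

    π-fromY' : ∀ y w (eq₀ : from c (g y) ≡ w) → π (fromY' y w eq₀) ≡ inj₂ y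
    π-fromY' y (inj₁ p) eq₀ = refl
    π-fromY' y (inj₂ q) eq₀ = refl

    π-fromY : ∀ y → π (fromY y) ≡ inj₂ y
    π-fromY y = π-fromY' y (from c (g y)) refl

    from' : X ⊎ Y → Dom
    from' (inj₁ x) = inj₁ (inj₁ x)
    from' (inj₂ y) = fromY y

    π-from' : ∀ u → π (from' u) ≡ u
    π-from' (inj₁ x) = refl
    π-from' (inj₂ y) = π-fromY y

  glue : Dom ↔ Fin k
  glue = ⤖⇒↔ (mk⤖ {to = glue-to}
    ( (λ e → π-inj (a-inj e))
    , λ j → from' (from a j) ,
        λ { refl → trans (cong (to a) (π-from' (from a j)))
                         (Inverse.strictlyInverseˡ a j) }))

shuffle : ((A ⊎ B) ⊎ (C ⊎ D)) ↔ ((A ⊎ C) ⊎ (B ⊎ D))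
shuffle = mk↔ₛ′ f f inv inv
  where
  f : ∀ {A B C D : Set} → ((A ⊎ B) ⊎ (C ⊎ D)) → ((A ⊎ C) ⊎ (B ⊎ D))
  f (inj₁ (inj₁ x)) = inj₁ (inj₁ x)
  f (inj₁ (inj₂ x)) = inj₂ (inj₁ x)
  f (inj₂ (inj₁ x)) = inj₁ (inj₂ x)
  f (inj₂ (inj₂ x)) = inj₂ (inj₂ x)
  inv : ∀ {A B C D : Set} (x : (A ⊎ B) ⊎ (C ⊎ D)) → f (f x) ≡ x
  inv (inj₁ (inj₁ x)) = refl
  inv (inj₁ (inj₂ x)) = refl
  inv (inj₂ (inj₁ x)) = refl
  inv (inj₂ (inj₂ x)) = refl

-- input/output edges of G keep their indices, those of H are shifted
-- by i(G) (resp. o(G)).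
_*G_ : Graph k l → Graph k' l' → Graph (k + k') (l + l')
G *G H = record
  { V = G.V ⊎ H.V ; E = G.E ⊎ H.E ; I = G.I ⊎ H.I ; O = G.O ⊎ H.O
  ; IO = G.IO ⊎ H.IO ; L = G.L ⊎ H.L
  ; V-fin = listable-⊎ G.V-fin H.V-fin
  ; E-fin = listable-⊎ G.E-fin H.E-fin
  ; L-fin = listable-⊎ G.L-fin H.L-fin
  ; s = λ { (inj₁ (inj₁ e)) → inj₁ (G.s (inj₁ e))
          ; (inj₁ (inj₂ e)) → inj₂ (H.s (inj₁ e))
          ; (inj₂ (inj₁ o)) → inj₁ (G.s (inj₂ o))
          ; (inj₂ (inj₂ o)) → inj₂ (H.s (inj₂ o)) }
  ; t = λ { (inj₁ (inj₁ e)) → inj₁ (G.t (inj₁ e))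
          ; (inj₁ (inj₂ e)) → inj₂ (H.t (inj₁ e))
          ; (inj₂ (inj₁ i)) → inj₁ (G.t (inj₂ i))
          ; (inj₂ (inj₂ i)) → inj₂ (H.t (inj₂ i)) }
  ; α = ↔-sym +↔⊎ ↔-∘ ((G.α ⊎-↔ H.α) ↔-∘ shuffle)
  ; β = ↔-sym +↔⊎ ↔-∘ ((G.β ⊎-↔ H.β) ↔-∘ shuffle)
  }
  where
  module G = Graph G
  module H = Graph H

_∘G_ : Graph l m → Graph k l → Graph k m
_∘G_ {l} {m} {k} H G = record
  { V = G.V ⊎ H.V
  ; E = (G.E ⊎ H.E) ⊎ MOI
  ; I = G.I ⊎ MIOI
  ; O = H.O ⊎ MOIO
  ; IO = MIOIO
  ; L = G.L ⊎ H.L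
  ; V-fin = listable-⊎ G.V-fin H.V-fin
  ; E-fin = listable-⊎ (listable-⊎ G.E-fin H.E-fin)
                       (listable-Match (listable-Fin↔ G.β) (listable-Fin↔ H.α))
  ; L-fin = listable-⊎ G.L-fin H.L-fin
  ; s = λ { (inj₁ (inj₁ (inj₁ e))) → inj₁ (G.s (inj₁ e))
          ; (inj₁ (inj₁ (inj₂ e))) → inj₂ (H.s (inj₁ e))
          ; (inj₁ (inj₂ (match f _ _))) → inj₁ (G.s (inj₂ f))
          ; (inj₂ (inj₁ o)) → inj₂ (H.s (inj₂ o))
          ; (inj₂ (inj₂ (match f _ _))) → inj₁ (G.s (inj₂ f)) }
  ; t = λ { (inj₁ (inj₁ (inj₁ e))) → inj₁ (G.t (inj₁ e))
          ; (inj₁ (inj₁ (inj₂ e))) → inj₂ (H.t (inj₁ e))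
          ; (inj₁ (inj₂ (match _ e _))) → inj₂ (H.t (inj₂ e))
          ; (inj₂ (inj₁ i)) → inj₁ (G.t (inj₂ i))
          ; (inj₂ (inj₂ (match _ e _))) → inj₂ (H.t (inj₂ e)) }
  ; α = GlueA.glue
  ; β = GlueB.glue ↔-∘ ((↔-id-⊎ flipMatch) ⊎-↔ flipMatch)
  }
  where
  module G = Graph G
  module H = Graph H
  βO : G.O → Fin l
  βO f = to G.β (inj₁ f)
  βIO : G.IO → Fin l
  βIO f = to G.β (inj₂ f)
  αI : H.I → Fin l
  αI e = to H.α (inj₁ e)
  αIO : H.IO → Fin l
  αIO e = to H.α (inj₂ e)
  MOI = Match βO αI
  MIOI = Match βIO αI
  MOIO = Match βO αIO
  MIOIO = Match βIO αIO

  inj-of : ∀ {U W : Set} {n} (e : (U ⊎ W) ↔ Fin n) {w w' : W} →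
           to e (inj₂ w) ≡ to e (inj₂ w') → w ≡ w'
  inj-of e {w} {w'} p = inj₂-injective
    (trans (sym (Inverse.strictlyInverseʳ e (inj₂ w)))
      (trans (cong (from e) p) (Inverse.strictlyInverseʳ e (inj₂ w'))))

  module GlueA = Glue G.α H.α βIO (inj-of G.β)
  module GlueB = Glue H.β G.β αIO (inj-of H.α)

  ↔-id-⊎ : ∀ {U W W' : Set} → W ↔ W' → (U ⊎ W) ↔ (U ⊎ W')
  ↔-id-⊎ e = mk↔ₛ′ (Sum.map (λ u → u) (to e)) (Sum.map (λ u → u) (from e))
    (λ { (inj₁ u) → refl ; (inj₂ w) → cong inj₂ (Inverse.strictlyInverseˡ e w) })
    (λ { (inj₁ u) → refl ; (inj₂ w) → cong inj₂ (Inverse.strictlyInverseʳ e w) })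

emptyGraph : Graph 0 0
emptyGraph = record
  { V = ⊥ ; E = ⊥ ; I = ⊥ ; O = ⊥ ; IO = ⊥ ; L = ⊥
  ; V-fin = listable-⊥ ; E-fin = listable-⊥ ; L-fin = listable-⊥
  ; s = λ { (inj₁ ()) ; (inj₂ ()) }
  ; t = λ { (inj₁ ()) ; (inj₂ ()) }
  ; α = mk↔ₛ′ (λ { (inj₁ ()) ; (inj₂ ()) }) (λ ()) (λ ()) (λ { (inj₁ ()) ; (inj₂ ()) })
  ; β = mk↔ₛ′ (λ { (inj₁ ()) ; (inj₂ ()) }) (λ ()) (λ ()) (λ { (inj₁ ()) ; (inj₂ ()) })
  }

edgeGraph : Graph 1 1
edgeGraph = record
  { V = ⊥ ; E = ⊥ ; I = ⊥ ; O = ⊥ ; IO = ⊤ ; L = ⊥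
  ; V-fin = listable-⊥ ; E-fin = listable-⊥ ; L-fin = listable-⊥
  ; s = λ { (inj₁ ()) ; (inj₂ ()) }
  ; t = λ { (inj₁ ()) ; (inj₂ ()) }
  ; α = e
  ; β = e
  }
  where
  e : (⊥ ⊎ ⊤) ↔ Fin 1
  e = mk↔ₛ′ (λ _ → Fin.zero) (λ _ → inj₂ tt)
        (λ { Fin.zero → refl ; (Fin.suc ()) }) (λ { (inj₁ ()) ; (inj₂ tt) → refl })
    where import Data.Fin as Fin

_⊗ₚ_ : Permutation′ m → Permutation′ n → Permutation′ (m + n)
σ ⊗ₚ σ' = ↔-sym +↔⊎ ↔-∘ ((σ ⊎-↔ σ') ↔-∘ +↔⊎)

cast↔ : m ≡ n → Fin m ↔ Fin n
cast↔ eq = mk↔ₛ′ (cast eq) (cast (sym eq)) (cast-involutive eq (sym eq))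
                 (cast-involutive (sym eq) eq)

-- c_{m,n}(i) = i + n for i ≤ m, i - m for i > m
cperm : ∀ m n → Permutation′ (m + n)
cperm m n = cast↔ (+-comm n m) ↔-∘ (↔-sym (+↔⊎ {n} {m}) ↔-∘ (⊎-comm _ _ ↔-∘ +↔⊎ {m} {n}))

module _ {a : Level} {P : ℕ → ℕ → Set a} where
  Iₙ : (∀ {k l k' l'} → P k l → P k' l' → P (k + k') (l + l')) →
       P 0 0 → P 1 1 → ∀ n → P n n
  Iₙ _*_ I₀ I₁ zero = I₀
  Iₙ _*_ I₀ I₁ (suc n) = I₁ * Iₙ _*_ I₀ I₁ n

record IsProP {c ℓ a b : Level} (K : Field c ℓ)
  (P : ℕ → ℕ → Set a)
  (_≈_ : ∀ {k l} → Rel (P k l) b)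
  (_⊞_ : ∀ {k l} → P k l → P k l → P k l)
  (0P : ∀ {k l} → P k l)
  (-_ : ∀ {k l} → P k l → P k l)
  (_·_ : ∀ {k l} → CommutativeRing.Carrier (Field.commutativeRing K) → P k l → P k l)
  (act : ∀ {k l} → Permutation′ l → P k l → P k l)
  (ract : ∀ {k l} → P k l → Permutation′ k → P k l)
  (_*_ : ∀ {k l k' l'} → P k l → P k' l' → P (k + k') (l + l'))
  (_∘_ : ∀ {k l m} → P l m → P k l → P k m)
  (I₀ : P 0 0) (I₁ : P 1 1)
  : Set (c ⊔ ℓ ⊔ a ⊔ b) where
  private
    R = Field.commutativeRing K
    K' = CommutativeRing.Carrier R
    I = Iₙ {P = P} _*_ I₀ I₁
  field
    isModule : ∀ k l → IsModule R (_≈_ {k} {l}) _⊞_ 0P -_ _·_ (λ x r → r · x)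

    act-cong  : ∀ {k l} (σ : Permutation′ l) {x y : P k l} → x ≈ y → act σ x ≈ act σ y
    act-+     : ∀ {k l} (σ : Permutation′ l) (x y : P k l) → act σ (x ⊞ y) ≈ (act σ x ⊞ act σ y)
    act-·     : ∀ {k l} (σ : Permutation′ l) r (x : P k l) → act σ (r · x) ≈ (r · act σ x)
    act-ext   : ∀ {k l} (σ σ' : Permutation′ l) (x : P k l) →
                (∀ i → σ ⟨$⟩ʳ i ≡ σ' ⟨$⟩ʳ i) → act σ x ≈ act σ' x
    act-id    : ∀ {k l} (x : P k l) → act idₚ x ≈ x
    -- (σ σ') · x = σ · (σ' · x), where σ σ' = σ ∘ σ' = σ' ∘ₚ σ
    act-comp  : ∀ {k l} (σ σ' : Permutation′ l) (x : P k l) →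
                act (σ' ∘ₚ σ) x ≈ act σ (act σ' x)
    ract-cong : ∀ {k l} (τ : Permutation′ k) {x y : P k l} → x ≈ y → ract x τ ≈ ract y τ
    ract-+    : ∀ {k l} (τ : Permutation′ k) (x y : P k l) → ract (x ⊞ y) τ ≈ (ract x τ ⊞ ract y τ)
    ract-·    : ∀ {k l} (τ : Permutation′ k) r (x : P k l) → ract (r · x) τ ≈ (r · ract x τ)
    ract-ext  : ∀ {k l} (τ τ' : Permutation′ k) (x : P k l) →
                (∀ i → τ ⟨$⟩ʳ i ≡ τ' ⟨$⟩ʳ i) → ract x τ ≈ ract x τ'
    ract-id   : ∀ {k l} (x : P k l) → ract x idₚ ≈ x
    ract-comp : ∀ {k l} (τ τ' : Permutation′ k) (x : P k l) →
                ract x (τ' ∘ₚ τ) ≈ ract (ract x τ) τ'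
    act-ract  : ∀ {k l} (σ : Permutation′ l) (τ : Permutation′ k) (x : P k l) →
                ract (act σ x) τ ≈ act σ (ract x τ)

    *-cong    : ∀ {k l k' l'} {x x' : P k l} {y y' : P k' l'} →
                x ≈ x' → y ≈ y' → (x * y) ≈ (x' * y')
    *-+ˡ      : ∀ {k l k' l'} (x x' : P k l) (y : P k' l') → ((x ⊞ x') * y) ≈ ((x * y) ⊞ (x' * y))
    *-+ʳ      : ∀ {k l k' l'} (x : P k l) (y y' : P k' l') → (x * (y ⊞ y')) ≈ ((x * y) ⊞ (x * y'))
    *-·ˡ      : ∀ {k l k' l'} r (x : P k l) (y : P k' l') → ((r · x) * y) ≈ (r · (x * y))
    *-·ʳ      : ∀ {k l k' l'} r (x : P k l) (y : P k' l') → (x * (r · y)) ≈ (r · (x * y))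
    *-assoc   : ∀ {k l k' l' k'' l''} (x : P k l) (y : P k' l') (z : P k'' l'') →
                subst₂ P (+-assoc k k' k'') (+-assoc l l' l'') ((x * y) * z) ≈ (x * (y * z))
    *-identityˡ : ∀ {k l} (x : P k l) → (I₀ * x) ≈ x
    *-identityʳ : ∀ {k l} (x : P k l) →
                  subst₂ P (+-identityʳ k) (+-identityʳ l) (x * I₀) ≈ x

    ∘-cong    : ∀ {k l m} {x x' : P l m} {y y' : P k l} →
                x ≈ x' → y ≈ y' → (x ∘ y) ≈ (x' ∘ y')
    ∘-+ˡ      : ∀ {k l m} (x x' : P l m) (y : P k l) → ((x ⊞ x') ∘ y) ≈ ((x ∘ y) ⊞ (x' ∘ y))
    ∘-+ʳ      : ∀ {k l m} (x : P l m) (y y' : P k l) → (x ∘ (y ⊞ y')) ≈ ((x ∘ y) ⊞ (x ∘ y'))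
    ∘-·ˡ      : ∀ {k l m} r (x : P l m) (y : P k l) → ((r · x) ∘ y) ≈ (r · (x ∘ y))
    ∘-·ʳ      : ∀ {k l m} r (x : P l m) (y : P k l) → (x ∘ (r · y)) ≈ (r · (x ∘ y))
    ∘-assoc   : ∀ {k l m n} (x : P m n) (y : P l m) (z : P k l) →
                ((x ∘ y) ∘ z) ≈ (x ∘ (y ∘ z))
    ∘-identityʳ : ∀ {k l} (x : P k l) → (x ∘ I k) ≈ x
    ∘-identityˡ : ∀ {k l} (x : P k l) → (I l ∘ x) ≈ x

    interchange : ∀ {k l m k' l' m'} (p : P l m) (p' : P l' m') (q : P k l) (q' : P k' l') →
                  ((p * p') ∘ (q * q')) ≈ ((p ∘ q) * (p' ∘ q'))

    act-∘     : ∀ {k l m} (σ : Permutation′ m) (p : P l m) (q : P k l) →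
                act σ (p ∘ q) ≈ (act σ p ∘ q)
    ract-∘    : ∀ {k l m} (ν : Permutation′ k) (p : P l m) (q : P k l) →
                ract (p ∘ q) ν ≈ (p ∘ ract q ν)
    ract-act-∘ : ∀ {k l m} (τ : Permutation′ l) (p : P l m) (q : P k l) →
                 (ract p τ ∘ q) ≈ (p ∘ act τ q)

    act-*     : ∀ {k l k' l'} (σ : Permutation′ l) (σ' : Permutation′ l')
                (p : P k l) (p' : P k' l') →
                (act σ p * act σ' p') ≈ act (σ ⊗ₚ σ') (p * p')
    ract-*    : ∀ {k l k' l'} (τ : Permutation′ k) (τ' : Permutation′ k')
                (p : P k l) (p' : P k' l') →
                (ract p τ * ract p' τ') ≈ ract (p * p') (τ ⊗ₚ τ')
    *-comm    : ∀ {k l k' l'} (p : P k l) (p' : P k' l') →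
                act (cperm l l') (p * p') ≈
                ract (subst₂ P (+-comm k' k) (+-comm l' l) (p' * p)) (cperm k k')

-- The ProP of graphs: Gr(k,l) is the free K-vector space on isomorphism
-- classes of graphs, presented as formal finite linear combinations of
-- graphs modulo the linear relations and graph isomorphism.

module GraphProP {c ℓ : Level} (K : Field c ℓ) where
  open CommutativeRing (Field.commutativeRing K)
    renaming (Carrier to 𝕂; _+_ to _+K_; _*_ to _*K_; -_ to -K_)

  Gr : ℕ → ℕ → Set (lsuc 0ℓ ⊔ c)
  Gr k l = List (𝕂 × Graph k l)

  infix 4 _≈Gr_
  data _≈Gr_ {k l : ℕ} : Gr k l → Gr k l → Set (lsuc 0ℓ ⊔ c ⊔ ℓ) where
    ≈-refl  : ∀ {xs} → xs ≈Gr xs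
    ≈-sym   : ∀ {xs ys} → xs ≈Gr ys → ys ≈Gr xs
    ≈-trans : ∀ {xs ys zs} → xs ≈Gr ys → ys ≈Gr zs → xs ≈Gr zs
    ≈-cons  : ∀ {a b G H xs ys} → a ≈ b → G ≅ H → xs ≈Gr ys →
              ((a , G) ∷ xs) ≈Gr ((b , H) ∷ ys)
    ≈-swap  : ∀ {x y xs} → (x ∷ y ∷ xs) ≈Gr (y ∷ x ∷ xs)
    ≈-merge : ∀ {a b G xs} → ((a , G) ∷ (b , G) ∷ xs) ≈Gr ((a +K b , G) ∷ xs)
    ≈-zero  : ∀ {G xs} → ((0# , G) ∷ xs) ≈Gr xs

  _+Gr_ : ∀ {k l} → Gr k l → Gr k l → Gr k l
  _+Gr_ = _++_

  0Gr : ∀ {k l} → Gr k l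
  0Gr = []

  -Gr_ : ∀ {k l} → Gr k l → Gr k l
  -Gr_ = map (λ { (a , G) → (-K a , G) })

  _·Gr_ : ∀ {k l} → 𝕂 → Gr k l → Gr k l
  r ·Gr xs = map (λ { (a , G) → (r *K a , G) }) xs

  actGr : ∀ {k l} → Permutation′ l → Gr k l → Gr k l
  actGr σ = map (λ { (a , G) → (a , σ ·G G) })

  ractGr : ∀ {k l} → Gr k l → Permutation′ k → Gr k l
  ractGr xs τ = map (λ { (a , G) → (a , G G· τ) }) xs

  _*Gr_ : ∀ {k l k' l'} → Gr k l → Gr k' l' → Gr (k + k') (l + l')
  xs *Gr ys = concatMap (λ { (a , G) → map (λ { (b , H) → (a *K b , G *G H) }) ys }) xs

  _∘Gr_ : ∀ {k l m} → Gr l m → Gr k l → Gr k m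
  ys ∘Gr xs = concatMap (λ { (b , H) → map (λ { (a , G) → (b *K a , H ∘G G) }) xs }) ys

  I₀Gr : Gr 0 0
  I₀Gr = (1# , emptyGraph) ∷ []

  I₁Gr : Gr 1 1
  I₁Gr = (1# , edgeGraph) ∷ []

module Submission where

-- The proof has two layers.  First, each ProP axiom is established for
-- single graphs as an explicit graph isomorphism.  Second, Gr k l consists of
-- formal linear combinations of graphs ('FormalSums'): it is a K-module,
-- the actions act termwise, * and ∘ are bilinear extensions ('Bilinear'),
-- and multilinear maps are determined by single terms ('ext₁' to 'ext₄').
-- So every axiom for Gr reduces to its graph isomorphism ('ProPLaws').

open import Defs
open import Level using (Level; _⊔_; 0ℓ) renaming (suc to lsuc)
open import Data.Empty using (⊥; ⊥-elim)
open import Data.Unit using (tt)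
open import Data.Nat using (ℕ; zero; suc; _+_)
open import Data.Nat.Properties using (+-comm; +-assoc; +-identityʳ)
open import Data.Fin using (Fin; join; splitAt; cast; toℕ; _↑ˡ_; _↑ʳ_)
open import Data.Fin.Properties
  using (_≟_; splitAt-join; splitAt-↑ˡ; splitAt-↑ʳ; ↑ˡ-injective; ↑ʳ-injective;
         cast-is-id; cast-involutive; toℕ-cast; toℕ-↑ˡ; toℕ-↑ʳ; toℕ-injective)
open import Data.Fin.Permutation using (Permutation′; _⟨$⟩ʳ_; _∘ₚ_) renaming (id to idₚ)
open import Data.Sum using (_⊎_; inj₁; inj₂)
import Data.Sum as Sum
open import Data.Sum.Algebra using (⊎-assoc; ⊎-comm)
open import Data.Sum.Function.Propositional using (_⊎-↔_)
open import Data.Product using (_×_; _,_)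
open import Data.List using ([]; _∷_; _++_; map; concatMap; [_])
import Data.List.Properties as List
import Data.List.Relation.Binary.Permutation.Propositional as Perm
open Perm using (_↭_)
open import Data.List.Relation.Binary.Permutation.Propositional.Properties
  using () renaming (shift to ↭-shift; ++-comm to ↭-++-comm)
open import Algebra.Bundles using (CommutativeRing)
open import Algebra.Structures using (IsCommutativeMonoid)
import Algebra.Properties.CommutativeSemigroup as CommutativeSemigroupProperties
import Algebra.Properties.Ring as RingProperties
open import Algebra.Module.Structures using (IsModule)
open import Function.Bundles using (_↔_; Inverse; mk↔ₛ′)
open import Function.Construct.Identity using (↔-id)
open import Function.Construct.Composition using (_↔-∘_)
open import Function.Properties.Inverse using (↔-sym)
open import Relation.Nullary.Decidable using (recompute)
open import Relation.Binary.PropositionalEquality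
  using (_≡_; refl; sym; trans; cong; subst₂)

private
  variable
    A B : Set
    k l m n k' l' m' k'' l'' : ℕ

to-from : (e : A ↔ B) (y : B) → to e (from e y) ≡ y
to-from = Inverse.strictlyInverseˡ

from-to : (e : A ↔ B) (x : A) → from e (to e x) ≡ x
from-to = Inverse.strictlyInverseʳ

-- Equality of Fin n is decidable, so the irrelevant matching condition
-- stored in a 'Match' can always be recovered as an ordinary proof.
recover : {i j : Fin m} → .(i ≡ j) → i ≡ j
recover {i = i} {j} p = recompute (i ≟ j) p

dropˡ : (A → ⊥) → (A ⊎ B) ↔ B
dropˡ h = mk↔ₛ′ (λ { (inj₁ a) → ⊥-elim (h a) ; (inj₂ b) → b }) inj₂ (λ _ → refl)
                (λ { (inj₁ a) → ⊥-elim (h a) ; (inj₂ b) → refl })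

dropʳ : (B → ⊥) → (A ⊎ B) ↔ A
dropʳ h = mk↔ₛ′ (λ { (inj₁ a) → a ; (inj₂ b) → ⊥-elim (h b) }) inj₁ (λ _ → refl)
                (λ { (inj₁ a) → refl ; (inj₂ b) → ⊥-elim (h b) })

↑ˡ≢↑ʳ : (i : Fin m) (j : Fin n) → i ↑ˡ n ≡ m ↑ʳ j → ⊥
↑ˡ≢↑ʳ {m} {n} i j eq
  with trans (sym (splitAt-↑ˡ m i n)) (trans (cong (splitAt m) eq) (splitAt-↑ʳ m n j))
... | ()

cast-toℕ : .(e : m ≡ n) {i : Fin m} {j : Fin n} → toℕ i ≡ toℕ j → cast e i ≡ j
cast-toℕ e {i} h = toℕ-injective (trans (toℕ-cast e i) h)

↑ˡ-identityʳ : (e : m + 0 ≡ m) (i : Fin m) → i ≡ cast e (i ↑ˡ 0)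
↑ˡ-identityʳ e i = sym (cast-toℕ e (toℕ-↑ˡ i 0))

module _ (k k' k'' : ℕ) where
  private e = +-assoc k k' k''

  ↑ˡ↑ˡ-assoc : (i : Fin k) → i ↑ˡ (k' + k'') ≡ cast e ((i ↑ˡ k') ↑ˡ k'')
  ↑ˡ↑ˡ-assoc i =
    sym (cast-toℕ e (trans (toℕ-↑ˡ _ k'') (trans (toℕ-↑ˡ i k') (sym (toℕ-↑ˡ i _)))))

  ↑ʳ↑ˡ-assoc : (i : Fin k') → k ↑ʳ (i ↑ˡ k'') ≡ cast e ((k ↑ʳ i) ↑ˡ k'')
  ↑ʳ↑ˡ-assoc i = sym (cast-toℕ e
    (trans (toℕ-↑ˡ _ k'') (trans (toℕ-↑ʳ k i)
      (sym (trans (toℕ-↑ʳ k _) (cong (k +_) (toℕ-↑ˡ i k'')))))))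

  ↑ʳ↑ʳ-assoc : (i : Fin k'') → k ↑ʳ (k' ↑ʳ i) ≡ cast e ((k + k') ↑ʳ i)
  ↑ʳ↑ʳ-assoc i = sym (cast-toℕ e
    (trans (toℕ-↑ʳ (k + k') i) (trans (+-assoc k k' _)
      (sym (trans (toℕ-↑ʳ k _) (cong (k +_) (toℕ-↑ʳ k' i)))))))

⊗-join : (σ : Permutation′ l) (σ' : Permutation′ l') (z : Fin l ⊎ Fin l') →
         to (σ ⊗ₚ σ') (join l l' z) ≡ join l l' (Sum.map (to σ) (to σ') z)
⊗-join {l} {l'} σ σ' z = cong (λ w → join l l' (Sum.map (to σ) (to σ') w)) (splitAt-join l l' z)

⊗-join-from : (σ : Permutation′ l) (σ' : Permutation′ l') (z : Fin l ⊎ Fin l') →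
              from (σ ⊗ₚ σ') (join l l' z) ≡ join l l' (Sum.map (from σ) (from σ') z)
⊗-join-from {l} {l'} σ σ' z =
  cong (λ w → join l l' (Sum.map (from σ) (from σ') w)) (splitAt-join l l' z)

cperm-join : ∀ m n (z : Fin m ⊎ Fin n) →
             to (cperm m n) (join m n z) ≡ cast (+-comm n m) (join n m (Sum.swap z))
cperm-join m n z = cong (λ w → cast (+-comm n m) (join n m (Sum.swap w))) (splitAt-join m n z)

cperm-join-from : ∀ m n (z : Fin n ⊎ Fin m) →
                  from (cperm m n) (cast (+-comm n m) (join n m z)) ≡ join m n (Sum.swap z)
cperm-join-from m n z =
  trans (cong (λ w → join m n (Sum.swap (splitAt n w)))
              (cast-involutive (sym (+-comm n m)) (+-comm n m) (join n m z)))
        (cong (λ w → join m n (Sum.swap w)) (splitAt-join n m z))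

-- Graph isomorphism is reflexive and transitive, which is all the
-- formal sums use besides the congruence lemmas below.
≅-refl : {G : Graph k l} → G ≅ G
≅-refl = record
  { φV = ↔-id _ ; φE = ↔-id _ ; φI = ↔-id _ ; φO = ↔-id _ ; φIO = ↔-id _ ; φL = ↔-id _
  ; s-comm = λ { (inj₁ _) → refl ; (inj₂ _) → refl }
  ; t-comm = λ { (inj₁ _) → refl ; (inj₂ _) → refl }
  ; α-comm = λ { (inj₁ _) → refl ; (inj₂ _) → refl }
  ; β-comm = λ { (inj₁ _) → refl ; (inj₂ _) → refl } }

≅-trans : {G H J : Graph k l} → G ≅ H → H ≅ J → G ≅ J
≅-trans p q = record
  { φV = Q.φV ↔-∘ P.φV ; φE = Q.φE ↔-∘ P.φE ; φI = Q.φI ↔-∘ P.φI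
  ; φO = Q.φO ↔-∘ P.φO ; φIO = Q.φIO ↔-∘ P.φIO ; φL = Q.φL ↔-∘ P.φL
  ; s-comm = λ { (inj₁ x) → trans (Q.s-comm (inj₁ (to P.φE x))) (cong (to Q.φV) (P.s-comm (inj₁ x)))
               ; (inj₂ x) → trans (Q.s-comm (inj₂ (to P.φO x))) (cong (to Q.φV) (P.s-comm (inj₂ x))) }
  ; t-comm = λ { (inj₁ x) → trans (Q.t-comm (inj₁ (to P.φE x))) (cong (to Q.φV) (P.t-comm (inj₁ x)))
               ; (inj₂ x) → trans (Q.t-comm (inj₂ (to P.φI x))) (cong (to Q.φV) (P.t-comm (inj₂ x))) }
  ; α-comm = λ { (inj₁ x) → trans (Q.α-comm (inj₁ (to P.φI x))) (P.α-comm (inj₁ x))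
               ; (inj₂ x) → trans (Q.α-comm (inj₂ (to P.φIO x))) (P.α-comm (inj₂ x)) }
  ; β-comm = λ { (inj₁ x) → trans (Q.β-comm (inj₁ (to P.φO x))) (P.β-comm (inj₁ x))
               ; (inj₂ x) → trans (Q.β-comm (inj₂ (to P.φIO x))) (P.β-comm (inj₂ x)) } }
  where
  module P = _≅_ p
  module Q = _≅_ q

-- Most laws that only re-index edges
-- (the symmetric group actions, casts) are instances of this.
≅-pointwise : (G : Graph k l) {s' : Graph.E G ⊎ Graph.O G → Graph.V G}
  {t' : Graph.E G ⊎ Graph.I G → Graph.V G}
  {α' : (Graph.I G ⊎ Graph.IO G) ↔ Fin k} {β' : (Graph.O G ⊎ Graph.IO G) ↔ Fin l} →
  (∀ x → s' x ≡ Graph.s G x) → (∀ x → t' x ≡ Graph.t G x) →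
  (∀ x → to α' x ≡ to (Graph.α G) x) → (∀ x → to β' x ≡ to (Graph.β G) x) →
  G ≅ record G { s = s' ; t = t' ; α = α' ; β = β' }
≅-pointwise G hs ht hα hβ = record
  { φV = ↔-id _ ; φE = ↔-id _ ; φI = ↔-id _ ; φO = ↔-id _ ; φIO = ↔-id _ ; φL = ↔-id _
  ; s-comm = λ { (inj₁ x) → hs (inj₁ x) ; (inj₂ x) → hs (inj₂ x) }
  ; t-comm = λ { (inj₁ x) → ht (inj₁ x) ; (inj₂ x) → ht (inj₂ x) }
  ; α-comm = λ { (inj₁ x) → hα (inj₁ x) ; (inj₂ x) → hα (inj₂ x) }
  ; β-comm = λ { (inj₁ x) → hβ (inj₁ x) ; (inj₂ x) → hβ (inj₂ x) } }

≅-relabel : (G : Graph k l) {α' : (Graph.I G ⊎ Graph.IO G) ↔ Fin k}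
  {β' : (Graph.O G ⊎ Graph.IO G) ↔ Fin l} →
  (∀ x → to α' x ≡ to (Graph.α G) x) → (∀ x → to β' x ≡ to (Graph.β G) x) →
  G ≅ record G { α = α' ; β = β' }
≅-relabel G = ≅-pointwise G (λ _ → refl) (λ _ → refl)

module _ {X Y X' Y' : Set} {f : X → Fin n} {g : Y → Fin n} {f' : X' → Fin m} {g' : Y' → Fin m} where

  Match-↔ : (φ : X ↔ X') (ψ : Y ↔ Y') →
            (∀ x y → f x ≡ g y → f' (to φ x) ≡ g' (to ψ y)) →
            (∀ x y → f' x ≡ g' y → f (from φ x) ≡ g (from ψ y)) →
            Match f g ↔ Match f' g'
  Match-↔ φ ψ fw bw = mk↔ₛ′
    (λ { (match x y p) → match (to φ x) (to ψ y) (fw x y (recover p)) })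
    (λ { (match x y p) → match (from φ x) (from ψ y) (bw x y (recover p)) })
    (λ { (match x y p) → match-≡ (to-from φ x) (to-from ψ y) })
    (λ { (match x y p) → match-≡ (from-to φ x) (from-to ψ y) })

module _ {X Y X' Y' : Set} {f : X → Fin n} {g : Y → Fin n} {f' : X' → Fin n} {g' : Y' → Fin n} where

  Match-↔-labelled : (φ : X ↔ X') (ψ : Y ↔ Y') →
                     (∀ x → f' (to φ x) ≡ f x) → (∀ y → g' (to ψ y) ≡ g y) →
                     Match f g ↔ Match f' g'
  Match-↔-labelled φ ψ hf hg = Match-↔ φ ψ
    (λ x y p → trans (hf x) (trans p (sym (hg y))))
    (λ x y p → trans (sym (hf (from φ x))) (trans (cong f' (to-from φ x))
                 (trans p (trans (sym (cong g' (to-from ψ y))) (hg (from ψ y))))))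

-- Matching against a side that is labelled bijectively pairs every
-- element of the other side with exactly one partner.
Match-bijˡ : {X Y : Set} (r : X ↔ Fin n) (g : Y → Fin n) → Match (to r) g ↔ Y
Match-bijˡ r g = mk↔ₛ′ Match.snd (λ y → match (from r (g y)) y (to-from r (g y))) (λ _ → refl)
  (λ { (match x y p) → match-≡ (trans (cong (from r) (sym (recover p))) (from-to r x)) refl })

Match-bijʳ : {X Y : Set} (f : X → Fin n) (r : Y ↔ Fin n) → Match f (to r) ↔ X
Match-bijʳ f r = mk↔ₛ′ Match.fst (λ x → match x (from r (f x)) (sym (to-from r (f x)))) (λ _ → refl)
  (λ { (match x y p) → match-≡ refl (trans (cong (from r) (recover p)) (from-to r y)) })

module MatchSplit {X X' Y Y' : Set}
  (F : X ⊎ X' → Fin (l + l')) (F' : Y ⊎ Y' → Fin (l + l'))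
  (f : X → Fin l) (f' : X' → Fin l') (g : Y → Fin l) (g' : Y' → Fin l')
  (hF₁ : ∀ x → F (inj₁ x) ≡ f x ↑ˡ l') (hF₂ : ∀ x → F (inj₂ x) ≡ l ↑ʳ f' x)
  (hG₁ : ∀ y → F' (inj₁ y) ≡ g y ↑ˡ l') (hG₂ : ∀ y → F' (inj₂ y) ≡ l ↑ʳ g' y) where

  split : Match F F' → Match f g ⊎ Match f' g'
  split (match (inj₁ x) (inj₁ y) p) =
    inj₁ (match x y (↑ˡ-injective l' _ _ (trans (sym (hF₁ x)) (trans p (hG₁ y)))))
  split (match (inj₂ x) (inj₂ y) p) =
    inj₂ (match x y (↑ʳ-injective l _ _ (trans (sym (hF₂ x)) (trans p (hG₂ y)))))
  split (match (inj₁ x) (inj₂ y) p) =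
    ⊥-elim (↑ˡ≢↑ʳ _ _ (trans (sym (hF₁ x)) (trans (recover p) (hG₂ y))))
  split (match (inj₂ x) (inj₁ y) p) =
    ⊥-elim (↑ˡ≢↑ʳ _ _ (sym (trans (sym (hF₂ x)) (trans (recover p) (hG₁ y)))))

  unsplit : Match f g ⊎ Match f' g' → Match F F'
  unsplit (inj₁ (match x y p)) =
    match (inj₁ x) (inj₁ y) (trans (hF₁ x) (trans (cong (_↑ˡ l') p) (sym (hG₁ y))))
  unsplit (inj₂ (match x y p)) =
    match (inj₂ x) (inj₂ y) (trans (hF₂ x) (trans (cong (l ↑ʳ_) p) (sym (hG₂ y))))

  split-↔ : Match F F' ↔ (Match f g ⊎ Match f' g')
  split-↔ = mk↔ₛ′ split unsplit (λ { (inj₁ _) → refl ; (inj₂ _) → refl })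
    (λ { (match (inj₁ x) (inj₁ y) p) → refl ; (match (inj₂ x) (inj₂ y) p) → refl
       ; (match (inj₁ x) (inj₂ y) p) → ⊥-elim (↑ˡ≢↑ʳ _ _ (trans (sym (hF₁ x)) (trans (recover p) (hG₂ y))))
       ; (match (inj₂ x) (inj₁ y) p) →
           ⊥-elim (↑ˡ≢↑ʳ _ _ (sym (trans (sym (hF₂ x)) (trans (recover p) (hG₁ y))))) })

-- Changing the arities along equations k ≡ k', l ≡ l' by casting the
-- labels; unlike 'subst₂ Graph', its labels can be computed with.
castG : k ≡ k' → l ≡ l' → Graph k l → Graph k' l'
castG e₁ e₂ G = record
  { V = G.V ; E = G.E ; I = G.I ; O = G.O ; IO = G.IO ; L = G.L
  ; V-fin = G.V-fin ; E-fin = G.E-fin ; L-fin = G.L-fin ; s = G.s ; t = G.t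
  ; α = cast↔ e₁ ↔-∘ G.α ; β = cast↔ e₂ ↔-∘ G.β }
  where module G = Graph G

subst≅castG : (e₁ : k ≡ k') (e₂ : l ≡ l') (G : Graph k l) → subst₂ Graph e₁ e₂ G ≅ castG e₁ e₂ G
subst≅castG refl refl G = ≅-relabel G (λ _ → cast-is-id refl _) (λ _ → cast-is-id refl _)

castG≅subst : (e₁ : k ≡ k') (e₂ : l ≡ l') (G : Graph k l) → castG e₁ e₂ G ≅ subst₂ Graph e₁ e₂ G
castG≅subst refl refl G = ≅-relabel (castG refl refl G)
  (λ _ → sym (cast-is-id refl _)) (λ _ → sym (cast-is-id refl _))

act-congG : (σ : Permutation′ l) {G G' : Graph k l} → G ≅ G' → (σ ·G G) ≅ (σ ·G G')
act-congG σ p = record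
  { φV = P.φV ; φE = P.φE ; φI = P.φI ; φO = P.φO ; φIO = P.φIO ; φL = P.φL
  ; s-comm = P.s-comm ; t-comm = P.t-comm ; α-comm = P.α-comm
  ; β-comm = λ x → cong (to σ) (P.β-comm x) }
  where module P = _≅_ p

ract-congG : (τ : Permutation′ k) {G G' : Graph k l} → G ≅ G' → (G G· τ) ≅ (G' G· τ)
ract-congG τ p = record
  { φV = P.φV ; φE = P.φE ; φI = P.φI ; φO = P.φO ; φIO = P.φIO ; φL = P.φL
  ; s-comm = P.s-comm ; t-comm = P.t-comm ; β-comm = P.β-comm
  ; α-comm = λ x → cong (from τ) (P.α-comm x) }
  where module P = _≅_ p

subst-congG : (e₁ : k ≡ k') (e₂ : l ≡ l') {G H : Graph k l} → G ≅ H →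
              subst₂ Graph e₁ e₂ G ≅ subst₂ Graph e₁ e₂ H
subst-congG refl refl p = p

*G-cong : {G G' : Graph k l} {H H' : Graph k' l'} → G ≅ G' → H ≅ H' → (G *G H) ≅ (G' *G H')
*G-cong {k} {l} {k'} {l'} p q = record
  { φV = P.φV ⊎-↔ Q.φV ; φE = P.φE ⊎-↔ Q.φE ; φI = P.φI ⊎-↔ Q.φI
  ; φO = P.φO ⊎-↔ Q.φO ; φIO = P.φIO ⊎-↔ Q.φIO ; φL = P.φL ⊎-↔ Q.φL
  ; s-comm = λ { (inj₁ (inj₁ e)) → cong inj₁ (P.s-comm (inj₁ e))
               ; (inj₁ (inj₂ e)) → cong inj₂ (Q.s-comm (inj₁ e))
               ; (inj₂ (inj₁ e)) → cong inj₁ (P.s-comm (inj₂ e))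
               ; (inj₂ (inj₂ e)) → cong inj₂ (Q.s-comm (inj₂ e)) }
  ; t-comm = λ { (inj₁ (inj₁ e)) → cong inj₁ (P.t-comm (inj₁ e))
               ; (inj₁ (inj₂ e)) → cong inj₂ (Q.t-comm (inj₁ e))
               ; (inj₂ (inj₁ e)) → cong inj₁ (P.t-comm (inj₂ e))
               ; (inj₂ (inj₂ e)) → cong inj₂ (Q.t-comm (inj₂ e)) }
  ; α-comm = λ { (inj₁ (inj₁ e)) → cong (_↑ˡ k') (P.α-comm (inj₁ e))
               ; (inj₁ (inj₂ e)) → cong (k ↑ʳ_) (Q.α-comm (inj₁ e))
               ; (inj₂ (inj₁ e)) → cong (_↑ˡ k') (P.α-comm (inj₂ e))
               ; (inj₂ (inj₂ e)) → cong (k ↑ʳ_) (Q.α-comm (inj₂ e)) }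
  ; β-comm = λ { (inj₁ (inj₁ e)) → cong (_↑ˡ l') (P.β-comm (inj₁ e))
               ; (inj₁ (inj₂ e)) → cong (l ↑ʳ_) (Q.β-comm (inj₁ e))
               ; (inj₂ (inj₁ e)) → cong (_↑ˡ l') (P.β-comm (inj₂ e))
               ; (inj₂ (inj₂ e)) → cong (l ↑ʳ_) (Q.β-comm (inj₂ e)) } }
  where
  module P = _≅_ p
  module Q = _≅_ q

∘G-cong : {H H' : Graph l m} {G G' : Graph k l} → H ≅ H' → G ≅ G' → (H ∘G G) ≅ (H' ∘G G')
∘G-cong q p = record
  { φV = P.φV ⊎-↔ Q.φV
  ; φE = (P.φE ⊎-↔ Q.φE) ⊎-↔ Match-↔-labelled P.φO Q.φI (λ x → P.β-comm (inj₁ x)) (λ x → Q.α-comm (inj₁ x))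
  ; φI = P.φI ⊎-↔ Match-↔-labelled P.φIO Q.φI (λ x → P.β-comm (inj₂ x)) (λ x → Q.α-comm (inj₁ x))
  ; φO = Q.φO ⊎-↔ Match-↔-labelled P.φO Q.φIO (λ x → P.β-comm (inj₁ x)) (λ x → Q.α-comm (inj₂ x))
  ; φIO = Match-↔-labelled P.φIO Q.φIO (λ x → P.β-comm (inj₂ x)) (λ x → Q.α-comm (inj₂ x))
  ; φL = P.φL ⊎-↔ Q.φL
  ; s-comm = λ { (inj₁ (inj₁ (inj₁ e))) → cong inj₁ (P.s-comm (inj₁ e))
               ; (inj₁ (inj₁ (inj₂ e))) → cong inj₂ (Q.s-comm (inj₁ e))
               ; (inj₁ (inj₂ (match f _ _))) → cong inj₁ (P.s-comm (inj₂ f))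
               ; (inj₂ (inj₁ o)) → cong inj₂ (Q.s-comm (inj₂ o))
               ; (inj₂ (inj₂ (match f _ _))) → cong inj₁ (P.s-comm (inj₂ f)) }
  ; t-comm = λ { (inj₁ (inj₁ (inj₁ e))) → cong inj₁ (P.t-comm (inj₁ e))
               ; (inj₁ (inj₁ (inj₂ e))) → cong inj₂ (Q.t-comm (inj₁ e))
               ; (inj₁ (inj₂ (match _ e _))) → cong inj₂ (Q.t-comm (inj₂ e))
               ; (inj₂ (inj₁ i)) → cong inj₁ (P.t-comm (inj₂ i))
               ; (inj₂ (inj₂ (match _ e _))) → cong inj₂ (Q.t-comm (inj₂ e)) }
  ; α-comm = λ { (inj₁ (inj₁ i)) → P.α-comm (inj₁ i)
               ; (inj₁ (inj₂ (match f _ _))) → P.α-comm (inj₂ f)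
               ; (inj₂ (match f _ _)) → P.α-comm (inj₂ f) }
  ; β-comm = λ { (inj₁ (inj₁ o)) → Q.β-comm (inj₁ o)
               ; (inj₁ (inj₂ (match _ e _))) → Q.β-comm (inj₂ e)
               ; (inj₂ (match _ e _)) → Q.β-comm (inj₂ e) } }
  where
  module P = _≅_ p
  module Q = _≅_ q

act-extG : (σ σ' : Permutation′ l) (G : Graph k l) → (∀ i → to σ i ≡ to σ' i) → (σ ·G G) ≅ (σ' ·G G)
act-extG σ σ' G h = ≅-relabel (σ ·G G) (λ _ → refl) (λ _ → sym (h _))

act-idG : (G : Graph k l) → (idₚ ·G G) ≅ G
act-idG G = ≅-relabel (idₚ ·G G) (λ _ → refl) (λ _ → refl)

act-compG : (σ σ' : Permutation′ l) (G : Graph k l) → ((σ' ∘ₚ σ) ·G G) ≅ (σ ·G (σ' ·G G))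
act-compG σ σ' G = ≅-relabel ((σ' ∘ₚ σ) ·G G) (λ _ → refl) (λ _ → refl)

ract-extG : (τ τ' : Permutation′ k) (G : Graph k l) → (∀ i → to τ i ≡ to τ' i) → (G G· τ) ≅ (G G· τ')
ract-extG τ τ' G h = ≅-relabel (G G· τ) (λ _ → from-agree _) (λ _ → refl)
  where
  from-agree : ∀ j → from τ' j ≡ from τ j
  from-agree j = trans (sym (from-to τ (from τ' j))) (cong (from τ) (trans (h (from τ' j)) (to-from τ' j)))

ract-idG : (G : Graph k l) → (G G· idₚ) ≅ G
ract-idG G = ≅-relabel (G G· idₚ) (λ _ → refl) (λ _ → refl)

ract-compG : (τ τ' : Permutation′ k) (G : Graph k l) → (G G· (τ' ∘ₚ τ)) ≅ ((G G· τ) G· τ')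
ract-compG τ τ' G = ≅-relabel (G G· (τ' ∘ₚ τ)) (λ _ → refl) (λ _ → refl)

act-ractG : (σ : Permutation′ l) (τ : Permutation′ k) (G : Graph k l) → ((σ ·G G) G· τ) ≅ (σ ·G (G G· τ))
act-ractG σ τ G = ≅-relabel ((σ ·G G) G· τ) (λ _ → refl) (λ _ → refl)

-- Compatibility of vertical concatenation with the actions: permuting
-- the outputs of H or the inputs of G does not change which edges are
-- glued, and permuting the middle indices on both sides is invisible.
act-∘G : (σ : Permutation′ m) (H : Graph l m) (G : Graph k l) → (σ ·G (H ∘G G)) ≅ ((σ ·G H) ∘G G)
act-∘G σ H G = ≅-pointwise (σ ·G (H ∘G G))
  (λ { (inj₁ (inj₁ (inj₁ _))) → refl ; (inj₁ (inj₁ (inj₂ _))) → refl ; (inj₁ (inj₂ _)) → refl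
     ; (inj₂ (inj₁ _)) → refl ; (inj₂ (inj₂ _)) → refl })
  (λ { (inj₁ (inj₁ (inj₁ _))) → refl ; (inj₁ (inj₁ (inj₂ _))) → refl ; (inj₁ (inj₂ _)) → refl
     ; (inj₂ (inj₁ _)) → refl ; (inj₂ (inj₂ _)) → refl })
  (λ { (inj₁ (inj₁ _)) → refl ; (inj₁ (inj₂ _)) → refl ; (inj₂ _) → refl })
  (λ { (inj₁ (inj₁ _)) → refl ; (inj₁ (inj₂ _)) → refl ; (inj₂ _) → refl })

ract-∘G : (ν : Permutation′ k) (H : Graph l m) (G : Graph k l) → ((H ∘G G) G· ν) ≅ (H ∘G (G G· ν))
ract-∘G ν H G = ≅-pointwise ((H ∘G G) G· ν)
  (λ { (inj₁ (inj₁ (inj₁ _))) → refl ; (inj₁ (inj₁ (inj₂ _))) → refl ; (inj₁ (inj₂ _)) → refl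
     ; (inj₂ (inj₁ _)) → refl ; (inj₂ (inj₂ _)) → refl })
  (λ { (inj₁ (inj₁ (inj₁ _))) → refl ; (inj₁ (inj₁ (inj₂ _))) → refl ; (inj₁ (inj₂ _)) → refl
     ; (inj₂ (inj₁ _)) → refl ; (inj₂ (inj₂ _)) → refl })
  (λ { (inj₁ (inj₁ _)) → refl ; (inj₁ (inj₂ _)) → refl ; (inj₂ _) → refl })
  (λ { (inj₁ (inj₁ _)) → refl ; (inj₁ (inj₂ _)) → refl ; (inj₂ _) → refl })

ract-act-∘G : (τ : Permutation′ l) (H : Graph l m) (G : Graph k l) → ((H G· τ) ∘G G) ≅ (H ∘G (τ ·G G))
ract-act-∘G {l} τ H G = record
  { φV = ↔-id _
  ; φE = ↔-id _ ⊎-↔ rematch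
  ; φI = ↔-id _ ⊎-↔ rematch
  ; φO = ↔-id _ ⊎-↔ rematch
  ; φIO = rematch
  ; φL = ↔-id _
  ; s-comm = λ { (inj₁ (inj₁ (inj₁ _))) → refl ; (inj₁ (inj₁ (inj₂ _))) → refl ; (inj₁ (inj₂ _)) → refl
               ; (inj₂ (inj₁ _)) → refl ; (inj₂ (inj₂ _)) → refl }
  ; t-comm = λ { (inj₁ (inj₁ (inj₁ _))) → refl ; (inj₁ (inj₁ (inj₂ _))) → refl ; (inj₁ (inj₂ _)) → refl
               ; (inj₂ (inj₁ _)) → refl ; (inj₂ (inj₂ _)) → refl }
  ; α-comm = λ { (inj₁ (inj₁ _)) → refl ; (inj₁ (inj₂ _)) → refl ; (inj₂ _) → refl }
  ; β-comm = λ { (inj₁ (inj₁ _)) → refl ; (inj₁ (inj₂ _)) → refl ; (inj₂ _) → refl } }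
  where
  -- f x = τ⁻¹ (g y)  iff  τ (f x) = g y
  rematch : ∀ {X Y : Set} {f : X → Fin l} {g : Y → Fin l} →
            Match f (λ y → from τ (g y)) ↔ Match (λ x → to τ (f x)) g
  rematch = Match-↔ (↔-id _) (↔-id _)
    (λ x y p → trans (cong (to τ) p) (to-from τ _))
    (λ x y p → trans (sym (from-to τ _)) (cong (from τ) p))

act-*G : (σ : Permutation′ l) (σ' : Permutation′ l') (G : Graph k l) (G' : Graph k' l') →
         ((σ ·G G) *G (σ' ·G G')) ≅ ((σ ⊗ₚ σ') ·G (G *G G'))
act-*G σ σ' G G' = ≅-pointwise ((σ ·G G) *G (σ' ·G G'))
  (λ { (inj₁ (inj₁ _)) → refl ; (inj₁ (inj₂ _)) → refl ; (inj₂ (inj₁ _)) → refl ; (inj₂ (inj₂ _)) → refl })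
  (λ { (inj₁ (inj₁ _)) → refl ; (inj₁ (inj₂ _)) → refl ; (inj₂ (inj₁ _)) → refl ; (inj₂ (inj₂ _)) → refl })
  (λ { (inj₁ (inj₁ _)) → refl ; (inj₁ (inj₂ _)) → refl ; (inj₂ (inj₁ _)) → refl ; (inj₂ (inj₂ _)) → refl })
  (λ { (inj₁ (inj₁ _)) → ⊗-join σ σ' (inj₁ _) ; (inj₁ (inj₂ _)) → ⊗-join σ σ' (inj₂ _)
     ; (inj₂ (inj₁ _)) → ⊗-join σ σ' (inj₁ _) ; (inj₂ (inj₂ _)) → ⊗-join σ σ' (inj₂ _) })

ract-*G : (τ : Permutation′ k) (τ' : Permutation′ k') (G : Graph k l) (G' : Graph k' l') →
          ((G G· τ) *G (G' G· τ')) ≅ ((G *G G') G· (τ ⊗ₚ τ'))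
ract-*G τ τ' G G' = ≅-pointwise ((G G· τ) *G (G' G· τ'))
  (λ { (inj₁ (inj₁ _)) → refl ; (inj₁ (inj₂ _)) → refl ; (inj₂ (inj₁ _)) → refl ; (inj₂ (inj₂ _)) → refl })
  (λ { (inj₁ (inj₁ _)) → refl ; (inj₁ (inj₂ _)) → refl ; (inj₂ (inj₁ _)) → refl ; (inj₂ (inj₂ _)) → refl })
  (λ { (inj₁ (inj₁ _)) → ⊗-join-from τ τ' (inj₁ _) ; (inj₁ (inj₂ _)) → ⊗-join-from τ τ' (inj₂ _)
     ; (inj₂ (inj₁ _)) → ⊗-join-from τ τ' (inj₁ _) ; (inj₂ (inj₂ _)) → ⊗-join-from τ τ' (inj₂ _) })
  (λ { (inj₁ (inj₁ _)) → refl ; (inj₁ (inj₂ _)) → refl ; (inj₂ (inj₁ _)) → refl ; (inj₂ (inj₂ _)) → refl })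

*-commG : (G : Graph k l) (G' : Graph k' l') →
          (cperm l l' ·G (G *G G')) ≅ (castG (+-comm k' k) (+-comm l' l) (G' *G G) G· cperm k k')
*-commG {k} {l} {k'} {l'} G G' = record
  { φV = ⊎-comm _ _ ; φE = ⊎-comm _ _ ; φI = ⊎-comm _ _ ; φO = ⊎-comm _ _ ; φIO = ⊎-comm _ _ ; φL = ⊎-comm _ _
  ; s-comm = λ { (inj₁ (inj₁ _)) → refl ; (inj₁ (inj₂ _)) → refl ; (inj₂ (inj₁ _)) → refl ; (inj₂ (inj₂ _)) → refl }
  ; t-comm = λ { (inj₁ (inj₁ _)) → refl ; (inj₁ (inj₂ _)) → refl ; (inj₂ (inj₁ _)) → refl ; (inj₂ (inj₂ _)) → refl }
  ; α-comm = λ { (inj₁ (inj₁ _)) → cperm-join-from k k' (inj₂ _) ; (inj₁ (inj₂ _)) → cperm-join-from k k' (inj₁ _)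
               ; (inj₂ (inj₁ _)) → cperm-join-from k k' (inj₂ _) ; (inj₂ (inj₂ _)) → cperm-join-from k k' (inj₁ _) }
  ; β-comm = λ { (inj₁ (inj₁ _)) → sym (cperm-join l l' (inj₁ _)) ; (inj₁ (inj₂ _)) → sym (cperm-join l l' (inj₂ _))
               ; (inj₂ (inj₁ _)) → sym (cperm-join l l' (inj₁ _)) ; (inj₂ (inj₂ _)) → sym (cperm-join l l' (inj₂ _)) } }

*-identityˡG : (G : Graph k l) → (emptyGraph *G G) ≅ G
*-identityˡG G = record
  { φV = dropˡ (λ ()) ; φE = dropˡ (λ ()) ; φI = dropˡ (λ ()) ; φO = dropˡ (λ ()) ; φIO = dropˡ (λ ()) ; φL = dropˡ (λ ())
  ; s-comm = λ { (inj₁ (inj₂ _)) → refl ; (inj₂ (inj₂ _)) → refl }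
  ; t-comm = λ { (inj₁ (inj₂ _)) → refl ; (inj₂ (inj₂ _)) → refl }
  ; α-comm = λ { (inj₁ (inj₂ _)) → refl ; (inj₂ (inj₂ _)) → refl }
  ; β-comm = λ { (inj₁ (inj₂ _)) → refl ; (inj₂ (inj₂ _)) → refl } }

*-identityʳG : (G : Graph k l) → castG (+-identityʳ k) (+-identityʳ l) (G *G emptyGraph) ≅ G
*-identityʳG {k} {l} G = record
  { φV = dropʳ (λ ()) ; φE = dropʳ (λ ()) ; φI = dropʳ (λ ()) ; φO = dropʳ (λ ()) ; φIO = dropʳ (λ ()) ; φL = dropʳ (λ ())
  ; s-comm = λ { (inj₁ (inj₁ _)) → refl ; (inj₂ (inj₁ _)) → refl }
  ; t-comm = λ { (inj₁ (inj₁ _)) → refl ; (inj₂ (inj₁ _)) → refl }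
  ; α-comm = λ { (inj₁ (inj₁ _)) → ↑ˡ-identityʳ (+-identityʳ k) _ ; (inj₂ (inj₁ _)) → ↑ˡ-identityʳ (+-identityʳ k) _ }
  ; β-comm = λ { (inj₁ (inj₁ _)) → ↑ˡ-identityʳ (+-identityʳ l) _ ; (inj₂ (inj₁ _)) → ↑ˡ-identityʳ (+-identityʳ l) _ } }

*-assocG : (G : Graph k l) (H : Graph k' l') (J : Graph k'' l'') →
           castG (+-assoc k k' k'') (+-assoc l l' l'') ((G *G H) *G J) ≅ (G *G (H *G J))
*-assocG {k} {l} {k'} {l'} {k''} {l''} G H J = record
  { φV = assoc ; φE = assoc ; φI = assoc ; φO = assoc ; φIO = assoc ; φL = assoc
  ; s-comm = λ { (inj₁ (inj₁ (inj₁ _))) → refl ; (inj₁ (inj₁ (inj₂ _))) → refl ; (inj₁ (inj₂ _)) → refl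
               ; (inj₂ (inj₁ (inj₁ _))) → refl ; (inj₂ (inj₁ (inj₂ _))) → refl ; (inj₂ (inj₂ _)) → refl }
  ; t-comm = λ { (inj₁ (inj₁ (inj₁ _))) → refl ; (inj₁ (inj₁ (inj₂ _))) → refl ; (inj₁ (inj₂ _)) → refl
               ; (inj₂ (inj₁ (inj₁ _))) → refl ; (inj₂ (inj₁ (inj₂ _))) → refl ; (inj₂ (inj₂ _)) → refl }
  ; α-comm = λ { (inj₁ (inj₁ (inj₁ _))) → ↑ˡ↑ˡ-assoc k k' k'' _ ; (inj₁ (inj₁ (inj₂ _))) → ↑ʳ↑ˡ-assoc k k' k'' _
               ; (inj₁ (inj₂ _)) → ↑ʳ↑ʳ-assoc k k' k'' _ ; (inj₂ (inj₁ (inj₁ _))) → ↑ˡ↑ˡ-assoc k k' k'' _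
               ; (inj₂ (inj₁ (inj₂ _))) → ↑ʳ↑ˡ-assoc k k' k'' _ ; (inj₂ (inj₂ _)) → ↑ʳ↑ʳ-assoc k k' k'' _ }
  ; β-comm = λ { (inj₁ (inj₁ (inj₁ _))) → ↑ˡ↑ˡ-assoc l l' l'' _ ; (inj₁ (inj₁ (inj₂ _))) → ↑ʳ↑ˡ-assoc l l' l'' _
               ; (inj₁ (inj₂ _)) → ↑ʳ↑ʳ-assoc l l' l'' _ ; (inj₂ (inj₁ (inj₁ _))) → ↑ˡ↑ˡ-assoc l l' l'' _
               ; (inj₂ (inj₁ (inj₂ _))) → ↑ʳ↑ˡ-assoc l l' l'' _ ; (inj₂ (inj₂ _)) → ↑ʳ↑ʳ-assoc l l' l'' _ } }
  where
  assoc : ∀ {A B C : Set} → ((A ⊎ B) ⊎ C) ↔ (A ⊎ (B ⊎ C))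
  assoc = ⊎-assoc _ _ _ _

-- A wiring is a graph consisting only of input-output edges, each with
-- equal input and output index.  Such graphs are units for ∘: gluing one
-- to an output (or input) side just renames the glued edges.
record Wiring (J : Graph n n) : Set where
  field
    noV : Graph.V J → ⊥
    noE : Graph.E J → ⊥
    noI : Graph.I J → ⊥
    noO : Graph.O J → ⊥
    noL : Graph.L J → ⊥
    αβ  : ∀ x → to (Graph.α J) (inj₂ x) ≡ to (Graph.β J) (inj₂ x)

∘-wiringʳ : (H : Graph k m) (J : Graph k k) → Wiring J → (H ∘G J) ≅ H
∘-wiringʳ H J w = record
  { φV = dropˡ noV
  ; φE = dropˡ noE ↔-∘ dropʳ (λ e → noO (Match.fst e))
  ; φI = Match-bijˡ βJ _ ↔-∘ dropˡ noI
  ; φO = dropʳ (λ e → noO (Match.fst e))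
  ; φIO = Match-bijˡ βJ _
  ; φL = dropˡ noL
  ; s-comm = λ { (inj₁ (inj₁ (inj₁ e))) → ⊥-elim (noE e) ; (inj₁ (inj₁ (inj₂ e))) → refl
               ; (inj₁ (inj₂ (match o _ _))) → ⊥-elim (noO o) ; (inj₂ (inj₁ o)) → refl
               ; (inj₂ (inj₂ (match o _ _))) → ⊥-elim (noO o) }
  ; t-comm = λ { (inj₁ (inj₁ (inj₁ e))) → ⊥-elim (noE e) ; (inj₁ (inj₁ (inj₂ e))) → refl
               ; (inj₁ (inj₂ (match o _ _))) → ⊥-elim (noO o) ; (inj₂ (inj₁ i)) → ⊥-elim (noI i)
               ; (inj₂ (inj₂ (match f e p))) → refl }
  ; α-comm = λ { (inj₁ (inj₁ i)) → ⊥-elim (noI i)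
               ; (inj₁ (inj₂ (match f e p))) → trans (sym (recover p)) (sym (αβ f))
               ; (inj₂ (match f e p)) → trans (sym (recover p)) (sym (αβ f)) }
  ; β-comm = λ { (inj₁ (inj₁ o)) → refl ; (inj₁ (inj₂ (match o _ _))) → ⊥-elim (noO o)
               ; (inj₂ (match f e p)) → refl } }
  where
  open Wiring w
  βJ = Graph.β J ↔-∘ ↔-sym (dropˡ noO)

∘-wiringˡ : (J : Graph l l) (G : Graph k l) → Wiring J → (J ∘G G) ≅ G
∘-wiringˡ J G w = record
  { φV = dropʳ noV
  ; φE = dropʳ noE ↔-∘ dropʳ (λ e → noI (Match.snd e))
  ; φI = dropʳ (λ e → noI (Match.snd e))
  ; φO = Match-bijʳ _ αJ ↔-∘ dropˡ noO
  ; φIO = Match-bijʳ _ αJ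
  ; φL = dropʳ noL
  ; s-comm = λ { (inj₁ (inj₁ (inj₁ e))) → refl ; (inj₁ (inj₁ (inj₂ e))) → ⊥-elim (noE e)
               ; (inj₁ (inj₂ (match _ e _))) → ⊥-elim (noI e) ; (inj₂ (inj₁ o)) → ⊥-elim (noO o)
               ; (inj₂ (inj₂ (match f e _))) → refl }
  ; t-comm = λ { (inj₁ (inj₁ (inj₁ e))) → refl ; (inj₁ (inj₁ (inj₂ e))) → ⊥-elim (noE e)
               ; (inj₁ (inj₂ (match _ e _))) → ⊥-elim (noI e) ; (inj₂ (inj₁ i)) → refl
               ; (inj₂ (inj₂ (match f e p))) → ⊥-elim (noI e) }
  ; α-comm = λ { (inj₁ (inj₁ i)) → refl
               ; (inj₁ (inj₂ (match f e p))) → ⊥-elim (noI e)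
               ; (inj₂ (match f e p)) → refl }
  ; β-comm = λ { (inj₁ (inj₁ o)) → ⊥-elim (noO o)
               ; (inj₁ (inj₂ (match o e p))) → trans (recover p) (αβ e)
               ; (inj₂ (match f e p)) → trans (recover p) (αβ e) } }
  where
  open Wiring w
  αJ = Graph.α J ↔-∘ ↔-sym (dropˡ noI)

idG : ∀ n → Graph n n
idG zero = emptyGraph
idG (suc n) = edgeGraph *G idG n

idG-wiring : ∀ n → Wiring (idG n)
idG-wiring zero = record { noV = λ () ; noE = λ () ; noI = λ () ; noO = λ () ; noL = λ () ; αβ = λ () }
idG-wiring (suc n) = record
  { noV = λ { (inj₂ v) → noV v }
  ; noE = λ { (inj₂ e) → noE e }
  ; noI = λ { (inj₂ i) → noI i }
  ; noO = λ { (inj₂ o) → noO o }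
  ; noL = λ { (inj₂ x) → noL x }
  ; αβ = λ { (inj₁ tt) → refl ; (inj₂ x) → cong (1 ↑ʳ_) (αβ x) } }
  where open Wiring (idG-wiring n)

-- Interchange law: gluing side by side and then stacking equals stacking
-- and then placing side by side, since a matching of concatenated
-- labels splits into matchings of the two halves ('MatchSplit').
interchangeG : (H : Graph l m) (H' : Graph l' m') (G : Graph k l) (G' : Graph k' l') →
               ((H *G H') ∘G (G *G G')) ≅ ((H ∘G G) *G (H' ∘G G'))
interchangeG {l} {m} {l'} {m'} {k} {k'} H H' G G' = record
  { φV = shuffle
  ; φE = shuffle ↔-∘ (shuffle ⊎-↔ ME.split-↔)
  ; φI = shuffle ↔-∘ (↔-id _ ⊎-↔ MI.split-↔)
  ; φO = shuffle ↔-∘ (↔-id _ ⊎-↔ MO.split-↔)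
  ; φIO = MIO.split-↔
  ; φL = shuffle
  ; s-comm = λ { (inj₁ (inj₁ (inj₁ (inj₁ _)))) → refl ; (inj₁ (inj₁ (inj₁ (inj₂ _)))) → refl
               ; (inj₁ (inj₁ (inj₂ (inj₁ _)))) → refl ; (inj₁ (inj₁ (inj₂ (inj₂ _)))) → refl
               ; (inj₁ (inj₂ (match (inj₁ x) (inj₁ y) p))) → refl
               ; (inj₁ (inj₂ (match (inj₂ x) (inj₂ y) p))) → refl
               ; (inj₁ (inj₂ (match (inj₁ x) (inj₂ y) p))) → ⊥-elim (↑ˡ≢↑ʳ _ _ (recover p))
               ; (inj₁ (inj₂ (match (inj₂ x) (inj₁ y) p))) → ⊥-elim (↑ˡ≢↑ʳ _ _ (sym (recover p)))
               ; (inj₂ (inj₁ (inj₁ _))) → refl ; (inj₂ (inj₁ (inj₂ _))) → refl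
               ; (inj₂ (inj₂ (match (inj₁ x) (inj₁ y) p))) → refl
               ; (inj₂ (inj₂ (match (inj₂ x) (inj₂ y) p))) → refl
               ; (inj₂ (inj₂ (match (inj₁ x) (inj₂ y) p))) → ⊥-elim (↑ˡ≢↑ʳ _ _ (recover p))
               ; (inj₂ (inj₂ (match (inj₂ x) (inj₁ y) p))) → ⊥-elim (↑ˡ≢↑ʳ _ _ (sym (recover p))) }
  ; t-comm = λ { (inj₁ (inj₁ (inj₁ (inj₁ _)))) → refl ; (inj₁ (inj₁ (inj₁ (inj₂ _)))) → refl
               ; (inj₁ (inj₁ (inj₂ (inj₁ _)))) → refl ; (inj₁ (inj₁ (inj₂ (inj₂ _)))) → refl
               ; (inj₁ (inj₂ (match (inj₁ x) (inj₁ y) p))) → refl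
               ; (inj₁ (inj₂ (match (inj₂ x) (inj₂ y) p))) → refl
               ; (inj₁ (inj₂ (match (inj₁ x) (inj₂ y) p))) → ⊥-elim (↑ˡ≢↑ʳ _ _ (recover p))
               ; (inj₁ (inj₂ (match (inj₂ x) (inj₁ y) p))) → ⊥-elim (↑ˡ≢↑ʳ _ _ (sym (recover p)))
               ; (inj₂ (inj₁ (inj₁ _))) → refl ; (inj₂ (inj₁ (inj₂ _))) → refl
               ; (inj₂ (inj₂ (match (inj₁ x) (inj₁ y) p))) → refl
               ; (inj₂ (inj₂ (match (inj₂ x) (inj₂ y) p))) → refl
               ; (inj₂ (inj₂ (match (inj₁ x) (inj₂ y) p))) → ⊥-elim (↑ˡ≢↑ʳ _ _ (recover p))
               ; (inj₂ (inj₂ (match (inj₂ x) (inj₁ y) p))) → ⊥-elim (↑ˡ≢↑ʳ _ _ (sym (recover p))) }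
  ; α-comm = λ { (inj₁ (inj₁ (inj₁ _))) → refl ; (inj₁ (inj₁ (inj₂ _))) → refl
               ; (inj₁ (inj₂ (match (inj₁ x) (inj₁ y) p))) → refl
               ; (inj₁ (inj₂ (match (inj₂ x) (inj₂ y) p))) → refl
               ; (inj₁ (inj₂ (match (inj₁ x) (inj₂ y) p))) → ⊥-elim (↑ˡ≢↑ʳ _ _ (recover p))
               ; (inj₁ (inj₂ (match (inj₂ x) (inj₁ y) p))) → ⊥-elim (↑ˡ≢↑ʳ _ _ (sym (recover p)))
               ; (inj₂ (match (inj₁ x) (inj₁ y) p)) → refl
               ; (inj₂ (match (inj₂ x) (inj₂ y) p)) → refl
               ; (inj₂ (match (inj₁ x) (inj₂ y) p)) → ⊥-elim (↑ˡ≢↑ʳ _ _ (recover p))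
               ; (inj₂ (match (inj₂ x) (inj₁ y) p)) → ⊥-elim (↑ˡ≢↑ʳ _ _ (sym (recover p))) }
  ; β-comm = λ { (inj₁ (inj₁ (inj₁ _))) → refl ; (inj₁ (inj₁ (inj₂ _))) → refl
               ; (inj₁ (inj₂ (match (inj₁ x) (inj₁ y) p))) → refl
               ; (inj₁ (inj₂ (match (inj₂ x) (inj₂ y) p))) → refl
               ; (inj₁ (inj₂ (match (inj₁ x) (inj₂ y) p))) → ⊥-elim (↑ˡ≢↑ʳ _ _ (recover p))
               ; (inj₁ (inj₂ (match (inj₂ x) (inj₁ y) p))) → ⊥-elim (↑ˡ≢↑ʳ _ _ (sym (recover p)))
               ; (inj₂ (match (inj₁ x) (inj₁ y) p)) → refl
               ; (inj₂ (match (inj₂ x) (inj₂ y) p)) → refl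
               ; (inj₂ (match (inj₁ x) (inj₂ y) p)) → ⊥-elim (↑ˡ≢↑ʳ _ _ (recover p))
               ; (inj₂ (match (inj₂ x) (inj₁ y) p)) → ⊥-elim (↑ˡ≢↑ʳ _ _ (sym (recover p))) } }
  where
  module G = Graph G
  module G' = Graph G'
  module H = Graph H
  module H' = Graph H'
  module ME = MatchSplit (λ x → to (Graph.β (G *G G')) (inj₁ x)) (λ y → to (Graph.α (H *G H')) (inj₁ y))
                (λ x → to G.β (inj₁ x)) (λ x → to G'.β (inj₁ x)) (λ y → to H.α (inj₁ y)) (λ y → to H'.α (inj₁ y))
                (λ _ → refl) (λ _ → refl) (λ _ → refl) (λ _ → refl)
  module MI = MatchSplit (λ x → to (Graph.β (G *G G')) (inj₂ x)) (λ y → to (Graph.α (H *G H')) (inj₁ y))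
                (λ x → to G.β (inj₂ x)) (λ x → to G'.β (inj₂ x)) (λ y → to H.α (inj₁ y)) (λ y → to H'.α (inj₁ y))
                (λ _ → refl) (λ _ → refl) (λ _ → refl) (λ _ → refl)
  module MO = MatchSplit (λ x → to (Graph.β (G *G G')) (inj₁ x)) (λ y → to (Graph.α (H *G H')) (inj₂ y))
                (λ x → to G.β (inj₁ x)) (λ x → to G'.β (inj₁ x)) (λ y → to H.α (inj₂ y)) (λ y → to H'.α (inj₂ y))
                (λ _ → refl) (λ _ → refl) (λ _ → refl) (λ _ → refl)
  module MIO = MatchSplit (λ x → to (Graph.β (G *G G')) (inj₂ x)) (λ y → to (Graph.α (H *G H')) (inj₂ y))
                (λ x → to G.β (inj₂ x)) (λ x → to G'.β (inj₂ x)) (λ y → to H.α (inj₂ y)) (λ y → to H'.α (inj₂ y))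
                (λ _ → refl) (λ _ → refl) (λ _ → refl) (λ _ → refl)

-- Associativity of ∘: both bracketings have the edges of A, B and C and
-- the same glued pairs, only nested differently; these bijections
-- re-nest the internal, input, output and input-output edges.
module ∘-Rebracket {k l m n : ℕ} (C : Graph m n) (B : Graph l m) (A : Graph k l) where
  private
    Lg = (C ∘G B) ∘G A
    Rg = C ∘G (B ∘G A)

  E→ : Graph.E Lg → Graph.E Rg
  E→ (inj₁ (inj₁ a)) = inj₁ (inj₁ (inj₁ (inj₁ a)))
  E→ (inj₁ (inj₂ (inj₁ (inj₁ b)))) = inj₁ (inj₁ (inj₁ (inj₂ b)))
  E→ (inj₁ (inj₂ (inj₁ (inj₂ c)))) = inj₁ (inj₂ c)
  E→ (inj₁ (inj₂ (inj₂ (match o e p)))) = inj₂ (match (inj₁ o) e p)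
  E→ (inj₂ (match f (inj₁ i) p)) = inj₁ (inj₁ (inj₂ (match f i p)))
  E→ (inj₂ (match f (inj₂ (match g e q)) p)) = inj₂ (match (inj₂ (match f g p)) e q)

  E← : Graph.E Rg → Graph.E Lg
  E← (inj₁ (inj₁ (inj₁ (inj₁ a)))) = inj₁ (inj₁ a)
  E← (inj₁ (inj₁ (inj₁ (inj₂ b)))) = inj₁ (inj₂ (inj₁ (inj₁ b)))
  E← (inj₁ (inj₂ c)) = inj₁ (inj₂ (inj₁ (inj₂ c)))
  E← (inj₂ (match (inj₁ o) e p)) = inj₁ (inj₂ (inj₂ (match o e p)))
  E← (inj₁ (inj₁ (inj₂ (match f i p)))) = inj₂ (match f (inj₁ i) p)
  E← (inj₂ (match (inj₂ (match f g p)) e q)) = inj₂ (match f (inj₂ (match g e q)) p)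

  φE : Graph.E Lg ↔ Graph.E Rg
  φE = mk↔ₛ′ E→ E←
    (λ { (inj₁ (inj₁ (inj₁ (inj₁ a)))) → refl ; (inj₁ (inj₁ (inj₁ (inj₂ b)))) → refl ; (inj₁ (inj₂ c)) → refl
       ; (inj₂ (match (inj₁ o) e p)) → refl ; (inj₁ (inj₁ (inj₂ (match f i p)))) → refl
       ; (inj₂ (match (inj₂ (match f g p)) e q)) → refl })
    (λ { (inj₁ (inj₁ a)) → refl ; (inj₁ (inj₂ (inj₁ (inj₁ b)))) → refl ; (inj₁ (inj₂ (inj₁ (inj₂ c)))) → refl
       ; (inj₁ (inj₂ (inj₂ (match o e p)))) → refl ; (inj₂ (match f (inj₁ i) p)) → refl
       ; (inj₂ (match f (inj₂ (match g e q)) p)) → refl })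

  I→ : Graph.I Lg → Graph.I Rg
  I→ (inj₁ a) = inj₁ (inj₁ a)
  I→ (inj₂ (match f (inj₁ i) p)) = inj₁ (inj₂ (match f i p))
  I→ (inj₂ (match f (inj₂ (match g e q)) p)) = inj₂ (match (match f g p) e q)

  I← : Graph.I Rg → Graph.I Lg
  I← (inj₁ (inj₁ a)) = inj₁ a
  I← (inj₁ (inj₂ (match f i p))) = inj₂ (match f (inj₁ i) p)
  I← (inj₂ (match (match f g p) e q)) = inj₂ (match f (inj₂ (match g e q)) p)

  φI : Graph.I Lg ↔ Graph.I Rg
  φI = mk↔ₛ′ I→ I←
    (λ { (inj₁ (inj₁ a)) → refl ; (inj₁ (inj₂ (match f i p))) → refl ; (inj₂ (match (match f g p) e q)) → refl })
    (λ { (inj₁ a) → refl ; (inj₂ (match f (inj₁ i) p)) → refl ; (inj₂ (match f (inj₂ (match g e q)) p)) → refl })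

  O→ : Graph.O Lg → Graph.O Rg
  O→ (inj₁ (inj₁ c)) = inj₁ c
  O→ (inj₁ (inj₂ (match o e p))) = inj₂ (match (inj₁ o) e p)
  O→ (inj₂ (match f (match g e q) p)) = inj₂ (match (inj₂ (match f g p)) e q)

  O← : Graph.O Rg → Graph.O Lg
  O← (inj₁ c) = inj₁ (inj₁ c)
  O← (inj₂ (match (inj₁ o) e p)) = inj₁ (inj₂ (match o e p))
  O← (inj₂ (match (inj₂ (match f g p)) e q)) = inj₂ (match f (match g e q) p)

  φO : Graph.O Lg ↔ Graph.O Rg
  φO = mk↔ₛ′ O→ O←
    (λ { (inj₁ c) → refl ; (inj₂ (match (inj₁ o) e p)) → refl ; (inj₂ (match (inj₂ (match f g p)) e q)) → refl })
    (λ { (inj₁ (inj₁ c)) → refl ; (inj₁ (inj₂ (match o e p))) → refl ; (inj₂ (match f (match g e q) p)) → refl })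

  φIO : Graph.IO Lg ↔ Graph.IO Rg
  φIO = mk↔ₛ′ (λ { (match f (match g e q) p) → match (match f g p) e q })
              (λ { (match (match f g p) e q) → match f (match g e q) p })
              (λ _ → refl) (λ _ → refl)

∘-assocG : (C : Graph m n) (B : Graph l m) (A : Graph k l) → ((C ∘G B) ∘G A) ≅ (C ∘G (B ∘G A))
∘-assocG C B A = record
  { φV = ↔-sym (⊎-assoc _ _ _ _) ; φE = φE ; φI = φI ; φO = φO ; φIO = φIO ; φL = ↔-sym (⊎-assoc _ _ _ _)
  ; s-comm = λ { (inj₁ (inj₁ (inj₁ a))) → refl ; (inj₁ (inj₁ (inj₂ (inj₁ (inj₁ b))))) → refl
               ; (inj₁ (inj₁ (inj₂ (inj₁ (inj₂ c))))) → refl ; (inj₁ (inj₁ (inj₂ (inj₂ (match o e p))))) → refl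
               ; (inj₁ (inj₂ (match f (inj₁ i) p))) → refl ; (inj₁ (inj₂ (match f (inj₂ (match g e q)) p))) → refl
               ; (inj₂ (inj₁ (inj₁ c))) → refl ; (inj₂ (inj₁ (inj₂ (match o e p)))) → refl
               ; (inj₂ (inj₂ (match f (match g e q) p))) → refl }
  ; t-comm = λ { (inj₁ (inj₁ (inj₁ a))) → refl ; (inj₁ (inj₁ (inj₂ (inj₁ (inj₁ b))))) → refl
               ; (inj₁ (inj₁ (inj₂ (inj₁ (inj₂ c))))) → refl ; (inj₁ (inj₁ (inj₂ (inj₂ (match o e p))))) → refl
               ; (inj₁ (inj₂ (match f (inj₁ i) p))) → refl ; (inj₁ (inj₂ (match f (inj₂ (match g e q)) p))) → refl
               ; (inj₂ (inj₁ a)) → refl ; (inj₂ (inj₂ (match f (inj₁ i) p))) → refl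
               ; (inj₂ (inj₂ (match f (inj₂ (match g e q)) p))) → refl }
  ; α-comm = λ { (inj₁ (inj₁ a)) → refl ; (inj₁ (inj₂ (match f (inj₁ i) p))) → refl
               ; (inj₁ (inj₂ (match f (inj₂ (match g e q)) p))) → refl
               ; (inj₂ (match f (match g e q) p)) → refl }
  ; β-comm = λ { (inj₁ (inj₁ (inj₁ c))) → refl ; (inj₁ (inj₁ (inj₂ (match o e p)))) → refl
               ; (inj₁ (inj₂ (match f (match g e q) p))) → refl
               ; (inj₂ (match f (match g e q) p)) → refl } }
  where open ∘-Rebracket C B A

-- An element of Gr k l is a list of terms
-- (a , G), read as the formal sum of the a·G, modulo _≈Gr_.  Every
-- operation of the ProP acts termwise ('termwise') or bilinearly
-- ('Bilinear'), so each ProP law follows from the corresponding graph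
-- isomorphism by the principle that multilinear maps agreeing on single
-- terms agree everywhere ('ext₁' … 'ext₄').
module FormalSums {c ℓ : Level} (K : Field c ℓ) where
  open GraphProP K
  R = Field.commutativeRing K
  module KR = CommutativeRing R
  open KR using (_≈_; 0#; 1#)
    renaming (Carrier to 𝕂; _+_ to _+K_; _*_ to _*K_; -_ to -K_)

  infixr 5 _⟫_
  _⟫_ : {xs ys zs : Gr k l} → xs ≈Gr ys → ys ≈Gr zs → xs ≈Gr zs
  _⟫_ = ≈-trans

  ≡⇒≈ : {xs ys : Gr k l} → xs ≡ ys → xs ≈Gr ys
  ≡⇒≈ refl = ≈-refl

  cons-cong : ∀ x {xs ys : Gr k l} → xs ≈Gr ys → (x ∷ xs) ≈Gr (x ∷ ys)
  cons-cong x p = ≈-cons KR.refl ≅-refl p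

  ↭⇒≈ : {xs ys : Gr k l} → xs ↭ ys → xs ≈Gr ys
  ↭⇒≈ Perm.refl = ≈-refl
  ↭⇒≈ (Perm.prep x p) = cons-cong x (↭⇒≈ p)
  ↭⇒≈ (Perm.swap x y p) = ≈-swap ⟫ cons-cong y (cons-cong x (↭⇒≈ p))
  ↭⇒≈ (Perm.trans p q) = ↭⇒≈ p ⟫ ↭⇒≈ q

  ++-congʳ : {xs xs' : Gr k l} (ys : Gr k l) → xs ≈Gr xs' → (xs ++ ys) ≈Gr (xs' ++ ys)
  ++-congʳ ys ≈-refl = ≈-refl
  ++-congʳ ys (≈-sym p) = ≈-sym (++-congʳ ys p)
  ++-congʳ ys (≈-trans p q) = ++-congʳ ys p ⟫ ++-congʳ ys q
  ++-congʳ ys (≈-cons a g p) = ≈-cons a g (++-congʳ ys p)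
  ++-congʳ ys ≈-swap = ≈-swap
  ++-congʳ ys ≈-merge = ≈-merge
  ++-congʳ ys ≈-zero = ≈-zero

  ++-congˡ : (xs : Gr k l) {ys ys' : Gr k l} → ys ≈Gr ys' → (xs ++ ys) ≈Gr (xs ++ ys')
  ++-congˡ [] p = p
  ++-congˡ (x ∷ xs) p = cons-cong x (++-congˡ xs p)

  ++-cong : {xs xs' ys ys' : Gr k l} → xs ≈Gr xs' → ys ≈Gr ys' → (xs ++ ys) ≈Gr (xs' ++ ys')
  ++-cong {xs' = xs'} {ys = ys} p q = ++-congʳ ys p ⟫ ++-congˡ xs' q

  ++-comm : (xs ys : Gr k l) → (xs ++ ys) ≈Gr (ys ++ xs)
  ++-comm xs ys = ↭⇒≈ (↭-++-comm xs ys)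

  ++-assoc : (xs ys zs : Gr k l) → ((xs ++ ys) ++ zs) ≈Gr (xs ++ (ys ++ zs))
  ++-assoc xs ys zs = ≡⇒≈ (List.++-assoc xs ys zs)

  ++-isCommutativeMonoid : IsCommutativeMonoid (_≈Gr_ {k} {l}) _++_ []
  ++-isCommutativeMonoid = record
    { isMonoid = record
      { isSemigroup = record
        { isMagma = record
          { isEquivalence = record { refl = ≈-refl ; sym = ≈-sym ; trans = ≈-trans }
          ; ∙-cong = ++-cong }
        ; assoc = ++-assoc }
      ; identity = (λ _ → ≈-refl) , (λ xs → ≡⇒≈ (List.++-identityʳ xs)) }
    ; comm = ++-comm }

  ++-interchange : (xs ys zs ws : Gr k l) →
                   ((xs ++ ys) ++ (zs ++ ws)) ≈Gr ((xs ++ zs) ++ (ys ++ ws))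
  ++-interchange {k} {l} = CommutativeSemigroupProperties.interchange
    (record { isCommutativeSemigroup =
                IsCommutativeMonoid.isCommutativeSemigroup (++-isCommutativeMonoid {k} {l}) })

  -- Scalar maps φ for which termwise application is well defined on
  -- formal sums: φ respects ≈, addition and zero.
  record IsAdditive (φ : 𝕂 → 𝕂) : Set (c ⊔ ℓ) where
    field
      ≈-hom : ∀ {a b} → a ≈ b → φ a ≈ φ b
      +-hom : ∀ a b → φ (a +K b) ≈ φ a +K φ b
      0-hom : φ 0# ≈ 0#

  id-additive : IsAdditive (λ a → a)
  id-additive = record { ≈-hom = λ p → p ; +-hom = λ _ _ → KR.refl ; 0-hom = KR.refl }

  *-additive : ∀ r → IsAdditive (r *K_)
  *-additive r = record { ≈-hom = KR.*-congˡ ; +-hom = KR.distribˡ r ; 0-hom = KR.zeroʳ r }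

  termwise : (𝕂 → 𝕂) → (Graph k l → Graph k' l') → Gr k l → Gr k' l'
  termwise φ T = map (λ (a , G) → (φ a , T G))

  termwise-++ : (φ : 𝕂 → 𝕂) (T : Graph k l → Graph k' l') (xs ys : Gr k l) →
                termwise φ T (xs ++ ys) ≡ termwise φ T xs ++ termwise φ T ys
  termwise-++ φ T = List.map-++ _

  termwise-∘ : (φ ψ : 𝕂 → 𝕂) (T : Graph k' l' → Graph m n) (S : Graph k l → Graph k' l') (xs : Gr k l) →
               termwise φ T (termwise ψ S xs) ≡ termwise (λ a → φ (ψ a)) (λ G → T (S G)) xs
  termwise-∘ φ ψ T S xs = sym (List.map-∘ xs)

  termwise-id : (xs : Gr k l) → termwise (λ a → a) (λ G → G) xs ≡ xs
  termwise-id = List.map-id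

  termwise-cong : {φ : 𝕂 → 𝕂} → IsAdditive φ → (T : Graph k l → Graph k' l') →
                  (∀ {G H} → G ≅ H → T G ≅ T H) →
                  {xs ys : Gr k l} → xs ≈Gr ys → termwise φ T xs ≈Gr termwise φ T ys
  termwise-cong φ T T-cong ≈-refl = ≈-refl
  termwise-cong φ T T-cong (≈-sym p) = ≈-sym (termwise-cong φ T T-cong p)
  termwise-cong φ T T-cong (≈-trans p q) = termwise-cong φ T T-cong p ⟫ termwise-cong φ T T-cong q
  termwise-cong φ T T-cong (≈-cons a g p) =
    ≈-cons (IsAdditive.≈-hom φ a) (T-cong g) (termwise-cong φ T T-cong p)
  termwise-cong φ T T-cong ≈-swap = ≈-swap
  termwise-cong φ T T-cong (≈-merge {a} {b}) = ≈-merge ⟫ ≈-cons (KR.sym (IsAdditive.+-hom φ a b)) ≅-refl ≈-refl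
  termwise-cong φ T T-cong ≈-zero = ≈-cons (IsAdditive.0-hom φ) ≅-refl ≈-refl ⟫ ≈-zero

  termwise-pointwise : {φ ψ : 𝕂 → 𝕂} {T S : Graph k l → Graph k' l'} →
                       (∀ a → φ a ≈ ψ a) → (∀ G → T G ≅ S G) →
                       (xs : Gr k l) → termwise φ T xs ≈Gr termwise ψ S xs
  termwise-pointwise hφ hT [] = ≈-refl
  termwise-pointwise hφ hT ((a , G) ∷ xs) = ≈-cons (hφ a) (hT G) (termwise-pointwise hφ hT xs)

  termwise-merge : {φ ψ χ : 𝕂 → 𝕂} (T : Graph k l → Graph k' l') → (∀ a → φ a +K ψ a ≈ χ a) →
                   (xs : Gr k l) → (termwise φ T xs ++ termwise ψ T xs) ≈Gr termwise χ T xs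
  termwise-merge T h [] = ≈-refl
  termwise-merge {φ = φ} {ψ} T h ((a , G) ∷ xs) =
    cons-cong _ (↭⇒≈ (↭-shift _ (termwise φ T xs) (termwise ψ T xs)))
    ⟫ ≈-merge ⟫ ≈-cons (h a) ≅-refl (termwise-merge T h xs)

  termwise-zero : {φ : 𝕂 → 𝕂} (T : Graph k l → Graph k' l') → (∀ a → φ a ≈ 0#) →
                  (xs : Gr k l) → termwise φ T xs ≈Gr []
  termwise-zero T h [] = ≈-refl
  termwise-zero T h ((a , G) ∷ xs) = ≈-cons (h a) ≅-refl ≈-refl ⟫ ≈-zero ⟫ termwise-zero T h xs

  ·-cong : ∀ {r s} {xs ys : Gr k l} → r ≈ s → xs ≈Gr ys → (r ·Gr xs) ≈Gr (s ·Gr ys)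
  ·-cong {r = r} {s} {ys = ys} h p =
    termwise-cong (*-additive r) (λ G → G) (λ g → g) p
    ⟫ termwise-pointwise (λ _ → KR.*-congʳ h) (λ _ → ≅-refl) ys

  -‿as-scaling : (xs : Gr k l) → (-Gr xs) ≈Gr ((-K 1#) ·Gr xs)
  -‿as-scaling = termwise-pointwise (λ a → KR.sym (RingProperties.-1*x≈-x KR.ring a)) (λ _ → ≅-refl)

  -‿cong : {xs ys : Gr k l} → xs ≈Gr ys → (-Gr xs) ≈Gr (-Gr ys)
  -‿cong {xs = xs} {ys} p = -‿as-scaling xs ⟫ ·-cong KR.refl p ⟫ ≈-sym (-‿as-scaling ys)

  -‿inverseʳ : (xs : Gr k l) → (xs ++ (-Gr xs)) ≈Gr []
  -‿inverseʳ xs =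
    ++-congʳ (-Gr xs) (≡⇒≈ (sym (termwise-id xs)))
    ⟫ termwise-merge {φ = λ a → a} {ψ = -K_} (λ G → G) KR.-‿inverseʳ xs
    ⟫ termwise-zero (λ G → G) (λ _ → KR.refl) xs

  -‿inverseˡ : (xs : Gr k l) → ((-Gr xs) ++ xs) ≈Gr []
  -‿inverseˡ xs = ++-comm (-Gr xs) xs ⟫ -‿inverseʳ xs

  ·-distribʳ : (xs : Gr k l) (r s : 𝕂) → ((r +K s) ·Gr xs) ≈Gr ((r ·Gr xs) ++ (s ·Gr xs))
  ·-distribʳ xs r s = ≈-sym (termwise-merge (λ G → G) (λ a → KR.sym (KR.distribʳ a r s)) xs)

  ·-identityˡ : (xs : Gr k l) → (1# ·Gr xs) ≈Gr xs
  ·-identityˡ xs = termwise-pointwise KR.*-identityˡ (λ _ → ≅-refl) xs ⟫ ≡⇒≈ (termwise-id xs)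

  ·-zeroˡ : (xs : Gr k l) → (0# ·Gr xs) ≈Gr []
  ·-zeroˡ = termwise-zero (λ G → G) KR.zeroˡ

  ·-assoc : (r s : 𝕂) (xs : Gr k l) → ((r *K s) ·Gr xs) ≈Gr (r ·Gr (s ·Gr xs))
  ·-assoc r s xs = termwise-pointwise (KR.*-assoc r s) (λ _ → ≅-refl) xs
    ⟫ ≡⇒≈ (sym (termwise-∘ (r *K_) (s *K_) (λ G → G) (λ G → G) xs))

  ·-comm : (r s : 𝕂) (xs : Gr k l) → (r ·Gr (s ·Gr xs)) ≈Gr (s ·Gr (r ·Gr xs))
  ·-comm r s xs = ≈-sym (·-assoc r s xs)
    ⟫ termwise-pointwise (λ a → KR.*-congʳ (KR.*-comm r s)) (λ _ → ≅-refl) xs ⟫ ·-assoc s r xs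

  isModuleGr : ∀ k l → IsModule R (_≈Gr_ {k} {l}) _+Gr_ 0Gr -Gr_ _·Gr_ (λ xs r → r ·Gr xs)
  isModuleGr k l = record
    { isBimodule = record
      { isBisemimodule = record
        { +ᴹ-isCommutativeMonoid = ++-isCommutativeMonoid
        ; isPreleftSemimodule = record
          { *ₗ-cong = ·-cong
          ; *ₗ-zeroˡ = ·-zeroˡ
          ; *ₗ-distribʳ = ·-distribʳ
          ; *ₗ-identityˡ = ·-identityˡ
          ; *ₗ-assoc = ·-assoc
          ; *ₗ-zeroʳ = λ _ → ≈-refl
          ; *ₗ-distribˡ = λ r xs ys → ≡⇒≈ (termwise-++ (r *K_) (λ G → G) xs ys) }
        ; isPrerightSemimodule = record
          { *ᵣ-cong = λ p h → ·-cong h p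
          ; *ᵣ-zeroʳ = ·-zeroˡ
          ; *ᵣ-distribˡ = ·-distribʳ
          ; *ᵣ-identityʳ = ·-identityˡ
          ; *ᵣ-assoc = λ xs r s → ·-comm s r xs ⟫ ≈-sym (·-assoc r s xs)
          ; *ᵣ-zeroˡ = λ _ → ≈-refl
          ; *ᵣ-distribʳ = λ r xs ys → ≡⇒≈ (termwise-++ (r *K_) (λ G → G) xs ys) }
        ; *ₗ-*ᵣ-assoc = λ r xs s → ·-comm s r xs }
      ; -ᴹ‿cong = -‿cong
      ; -ᴹ‿inverse = -‿inverseˡ , -‿inverseʳ }
    ; *ₗ-*ᵣ-coincident = λ _ _ → ≈-refl }

  -- Maps of formal sums that are additive and respect ≈Gr.  Since the
  -- scalars are carried by the terms, such a map is determined by its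
  -- values on single terms ('ext₁').
  record IsLinear (Φ : Gr k l → Gr k' l') : Set (lsuc 0ℓ ⊔ c ⊔ ℓ) where
    field
      ++-hom : ∀ xs ys → Φ (xs ++ ys) ≈Gr (Φ xs ++ Φ ys)
      []-hom : Φ [] ≈Gr []
      ≈-hom  : ∀ {xs ys} → xs ≈Gr ys → Φ xs ≈Gr Φ ys
  open IsLinear

  id-linear : IsLinear {k} {l} (λ xs → xs)
  id-linear = record { ++-hom = λ _ _ → ≈-refl ; []-hom = ≈-refl ; ≈-hom = λ p → p }

  ∘-linear : {Φ : Gr k l → Gr k' l'} {Ψ : Gr k' l' → Gr m n} →
             IsLinear Φ → IsLinear Ψ → IsLinear (λ xs → Ψ (Φ xs))
  ∘-linear {Φ = Φ} p q = record
    { ++-hom = λ xs ys → ≈-hom q (++-hom p xs ys) ⟫ ++-hom q (Φ xs) (Φ ys)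
    ; []-hom = ≈-hom q ([]-hom p) ⟫ []-hom q
    ; ≈-hom = λ r → ≈-hom q (≈-hom p r) }

  termwise-linear : {φ : 𝕂 → 𝕂} → IsAdditive φ → (T : Graph k l → Graph k' l') →
                    (∀ {G H} → G ≅ H → T G ≅ T H) → IsLinear (termwise φ T)
  termwise-linear {φ = φ} φ-additive T T-cong = record
    { ++-hom = λ xs ys → ≡⇒≈ (termwise-++ φ T xs ys)
    ; []-hom = ≈-refl
    ; ≈-hom = termwise-cong φ-additive T T-cong }

  graphwise-linear : (T : Graph k l → Graph k' l') → (∀ {G H} → G ≅ H → T G ≅ T H) →
                     IsLinear (termwise (λ a → a) T)
  graphwise-linear = termwise-linear id-additive

  ext₁ : {Φ Ψ : Gr k l → Gr k' l'} → IsLinear Φ → IsLinear Ψ →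
         (∀ x → Φ [ x ] ≈Gr Ψ [ x ]) → ∀ xs → Φ xs ≈Gr Ψ xs
  ext₁ p q h [] = []-hom p ⟫ ≈-sym ([]-hom q)
  ext₁ p q h (x ∷ xs) = ++-hom p [ x ] xs ⟫ ++-cong (h x) (ext₁ p q h xs) ⟫ ≈-sym (++-hom q [ x ] xs)

  module Bilinear {a b a' b' e f : ℕ} (_⊙_ : Graph a b → Graph a' b' → Graph e f)
    (⊙-congˡ : ∀ {G G' H} → G ≅ G' → (G ⊙ H) ≅ (G' ⊙ H))
    (⊙-congʳ : ∀ {G H H'} → H ≅ H' → (G ⊙ H) ≅ (G ⊙ H')) where

    bil : Gr a b → Gr a' b' → Gr e f
    bil xs ys = concatMap (λ (r , G) → map (λ (s , H) → (r *K s , G ⊙ H)) ys) xs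

    row : 𝕂 × Graph a b → Gr a' b' → Gr e f
    row (r , G) = termwise (r *K_) (G ⊙_)

    bil-++ˡ : ∀ xs xs' ys → bil (xs ++ xs') ys ≡ bil xs ys ++ bil xs' ys
    bil-++ˡ xs xs' ys = List.concatMap-++ _ xs xs'

    bil-[]ʳ : ∀ xs → bil xs [] ≡ []
    bil-[]ʳ [] = refl
    bil-[]ʳ (x ∷ xs) = bil-[]ʳ xs

    bil-++ʳ : ∀ xs ys ys' → bil xs (ys ++ ys') ≈Gr (bil xs ys ++ bil xs ys')
    bil-++ʳ [] ys ys' = ≈-refl
    bil-++ʳ (x ∷ xs) ys ys' =
      ++-cong (≡⇒≈ (termwise-++ _ _ ys ys')) (bil-++ʳ xs ys ys')
      ⟫ ++-interchange (row x ys) (row x ys') (bil xs ys) (bil xs ys')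

    bil-congˡ : ∀ {xs xs'} ys → xs ≈Gr xs' → bil xs ys ≈Gr bil xs' ys
    bil-congˡ ys ≈-refl = ≈-refl
    bil-congˡ ys (≈-sym p) = ≈-sym (bil-congˡ ys p)
    bil-congˡ ys (≈-trans p q) = bil-congˡ ys p ⟫ bil-congˡ ys q
    bil-congˡ ys (≈-cons h g p) =
      ++-cong (termwise-pointwise (λ _ → KR.*-congʳ h) (λ _ → ⊙-congˡ g) ys) (bil-congˡ ys p)
    bil-congˡ ys (≈-swap {x} {y} {xs}) =
      ≈-sym (++-assoc (row x ys) (row y ys) (bil xs ys))
      ⟫ ++-congʳ (bil xs ys) (++-comm (row x ys) (row y ys))
      ⟫ ++-assoc (row y ys) (row x ys) (bil xs ys)
    bil-congˡ ys (≈-merge {a} {b} {G} {xs}) =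
      ≈-sym (++-assoc (row (a , G) ys) (row (b , G) ys) (bil xs ys))
      ⟫ ++-congʳ (bil xs ys) (termwise-merge (G ⊙_) (λ s → KR.sym (KR.distribʳ s a b)) ys)
    bil-congˡ ys (≈-zero {G} {xs}) = ++-congʳ (bil xs ys) (termwise-zero (G ⊙_) KR.zeroˡ ys)

    bil-congʳ : ∀ xs {ys ys'} → ys ≈Gr ys' → bil xs ys ≈Gr bil xs ys'
    bil-congʳ [] p = ≈-refl
    bil-congʳ ((r , G) ∷ xs) p =
      ++-cong (termwise-cong (*-additive r) (G ⊙_) ⊙-congʳ p) (bil-congʳ xs p)

    linearˡ : ∀ ys → IsLinear (λ xs → bil xs ys)
    linearˡ ys = record
      { ++-hom = λ xs xs' → ≡⇒≈ (bil-++ˡ xs xs' ys) ; []-hom = ≈-refl ; ≈-hom = bil-congˡ ys }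

    linearʳ : ∀ xs → IsLinear (bil xs)
    linearʳ xs = record { ++-hom = bil-++ʳ xs ; []-hom = ≡⇒≈ (bil-[]ʳ xs) ; ≈-hom = bil-congʳ xs }

    bil-·ˡ : ∀ r xs ys → bil (r ·Gr xs) ys ≈Gr (r ·Gr bil xs ys)
    bil-·ˡ r [] ys = ≈-refl
    bil-·ˡ r ((a , G) ∷ xs) ys =
      ++-cong (termwise-pointwise (KR.*-assoc r a) (λ _ → ≅-refl) ys
               ⟫ ≡⇒≈ (sym (termwise-∘ (r *K_) (a *K_) (λ H → H) (G ⊙_) ys)))
              (bil-·ˡ r xs ys)
      ⟫ ≡⇒≈ (sym (termwise-++ (r *K_) (λ H → H) (row (a , G) ys) (bil xs ys)))

    bil-·ʳ : ∀ r xs ys → bil xs (r ·Gr ys) ≈Gr (r ·Gr bil xs ys)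
    bil-·ʳ r [] ys = ≈-refl
    bil-·ʳ r ((a , G) ∷ xs) ys =
      ++-cong (≡⇒≈ (termwise-∘ (a *K_) (r *K_) (G ⊙_) (λ H → H) ys)
               ⟫ termwise-pointwise (λ s → KR.trans (KR.sym (KR.*-assoc a r s))
                   (KR.trans (KR.*-congʳ (KR.*-comm a r)) (KR.*-assoc r a s))) (λ _ → ≅-refl) ys
               ⟫ ≡⇒≈ (sym (termwise-∘ (r *K_) (a *K_) (λ H → H) (G ⊙_) ys)))
              (bil-·ʳ r xs ys)
      ⟫ ≡⇒≈ (sym (termwise-++ (r *K_) (λ H → H) (row (a , G) ys) (bil xs ys)))

  ext₂ : ∀ {a₁ b₁ a₂ b₂ e f} {Φ Ψ : Gr a₁ b₁ → Gr a₂ b₂ → Gr e f} →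
         (∀ y → IsLinear (λ x → Φ x y)) → (∀ x → IsLinear (Φ x)) →
         (∀ y → IsLinear (λ x → Ψ x y)) → (∀ x → IsLinear (Ψ x)) →
         (∀ x y → Φ [ x ] [ y ] ≈Gr Ψ [ x ] [ y ]) → ∀ xs ys → Φ xs ys ≈Gr Ψ xs ys
  ext₂ Φ₁ Φ₂ Ψ₁ Ψ₂ h xs ys = ext₁ (Φ₁ ys) (Ψ₁ ys) (λ x → ext₁ (Φ₂ [ x ]) (Ψ₂ [ x ]) (h x) ys) xs

  ext₃ : ∀ {a₁ b₁ a₂ b₂ a₃ b₃ e f} {Φ Ψ : Gr a₁ b₁ → Gr a₂ b₂ → Gr a₃ b₃ → Gr e f} →
         (∀ y z → IsLinear (λ x → Φ x y z)) → (∀ x z → IsLinear (λ y → Φ x y z)) → (∀ x y → IsLinear (Φ x y)) →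
         (∀ y z → IsLinear (λ x → Ψ x y z)) → (∀ x z → IsLinear (λ y → Ψ x y z)) → (∀ x y → IsLinear (Ψ x y)) →
         (∀ x y z → Φ [ x ] [ y ] [ z ] ≈Gr Ψ [ x ] [ y ] [ z ]) → ∀ xs ys zs → Φ xs ys zs ≈Gr Ψ xs ys zs
  ext₃ Φ₁ Φ₂ Φ₃ Ψ₁ Ψ₂ Ψ₃ h xs ys zs = ext₁ (Φ₁ ys zs) (Ψ₁ ys zs)
    (λ x → ext₂ (Φ₂ [ x ]) (Φ₃ [ x ]) (Ψ₂ [ x ]) (Ψ₃ [ x ]) (h x) ys zs) xs

  ext₄ : ∀ {a₁ b₁ a₂ b₂ a₃ b₃ a₄ b₄ e f} {Φ Ψ : Gr a₁ b₁ → Gr a₂ b₂ → Gr a₃ b₃ → Gr a₄ b₄ → Gr e f} →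
         (∀ y z w → IsLinear (λ x → Φ x y z w)) → (∀ x z w → IsLinear (λ y → Φ x y z w)) →
         (∀ x y w → IsLinear (λ z → Φ x y z w)) → (∀ x y z → IsLinear (Φ x y z)) →
         (∀ y z w → IsLinear (λ x → Ψ x y z w)) → (∀ x z w → IsLinear (λ y → Ψ x y z w)) →
         (∀ x y w → IsLinear (λ z → Ψ x y z w)) → (∀ x y z → IsLinear (Ψ x y z)) →
         (∀ x y z w → Φ [ x ] [ y ] [ z ] [ w ] ≈Gr Ψ [ x ] [ y ] [ z ] [ w ]) →
         ∀ xs ys zs ws → Φ xs ys zs ws ≈Gr Ψ xs ys zs ws
  ext₄ Φ₁ Φ₂ Φ₃ Φ₄ Ψ₁ Ψ₂ Ψ₃ Ψ₄ h xs ys zs ws = ext₁ (Φ₁ ys zs ws) (Ψ₁ ys zs ws)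
    (λ x → ext₃ (Φ₂ [ x ]) (Φ₃ [ x ]) (Φ₄ [ x ]) (Ψ₂ [ x ]) (Ψ₃ [ x ]) (Ψ₄ [ x ]) (h x) ys zs ws) xs

-- Each axiom of a ProP for Gr, under the name of the corresponding field
-- of 'IsProP'.  Every law is reduced by multilinear extensionality to the
-- graph isomorphism established above.
module ProPLaws {c ℓ : Level} (K : Field c ℓ) where
  open GraphProP K
  open FormalSums K
  open IsLinear
  open KR using (1#) renaming (Carrier to 𝕂)

  module Horizontal {k l k' l'} = Bilinear {k} {l} {k'} {l'} _*G_ (λ g → *G-cong g ≅-refl) (*G-cong ≅-refl)
  module Vertical {k l m} = Bilinear {l} {m} {k} {l} _∘G_ (λ g → ∘G-cong g ≅-refl) (∘G-cong ≅-refl)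
  open Horizontal using () renaming (linearˡ to *-linearˡ; linearʳ to *-linearʳ)
  open Vertical using () renaming (linearˡ to ∘-linearˡ; linearʳ to ∘-linearʳ)

  act-linear : (σ : Permutation′ l) → IsLinear {k} (actGr σ)
  act-linear σ = graphwise-linear (σ ·G_) (act-congG σ)

  ract-linear : (τ : Permutation′ k) → IsLinear {k} {l} (λ xs → ractGr xs τ)
  ract-linear τ = graphwise-linear (_G· τ) (ract-congG τ)

  subst-graphwise : (e₁ : k ≡ k') (e₂ : l ≡ l') (xs : Gr k l) →
                    subst₂ Gr e₁ e₂ xs ≡ termwise (λ a → a) (subst₂ Graph e₁ e₂) xs
  subst-graphwise refl refl xs = sym (termwise-id xs)

  subst-linear : (e₁ : k ≡ k') (e₂ : l ≡ l') → IsLinear (termwise (λ a → a) (subst₂ Graph e₁ e₂))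
  subst-linear e₁ e₂ = graphwise-linear (subst₂ Graph e₁ e₂) (subst-congG e₁ e₂)

  graphwise-· : (T : Graph k l → Graph k' l') (r : 𝕂) (xs : Gr k l) →
                termwise (λ a → a) T (r ·Gr xs) ≡ r ·Gr termwise (λ a → a) T xs
  graphwise-· T r [] = refl
  graphwise-· T r (x ∷ xs) = cong (_ ∷_) (graphwise-· T r xs)

  graphwise-∘ : (T : Graph k' l' → Graph m n) (S : Graph k l → Graph k' l') (xs : Gr k l) →
                termwise (λ a → a) T (termwise (λ a → a) S xs) ≡ termwise (λ a → a) (λ G → T (S G)) xs
  graphwise-∘ T S = termwise-∘ (λ a → a) (λ a → a) T S

  graphwise-≅ : {T S : Graph k l → Graph k' l'} → (∀ G → T G ≅ S G) →
                (xs : Gr k l) → termwise (λ a → a) T xs ≈Gr termwise (λ a → a) S xs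
  graphwise-≅ = termwise-pointwise (λ _ → KR.refl)

  Iₙ-single : ∀ n → Iₙ {P = Gr} _*Gr_ I₀Gr I₁Gr n ≈Gr [ (1# , idG n) ]
  Iₙ-single zero = ≈-refl
  Iₙ-single (suc n) =
    Horizontal.bil-congʳ I₁Gr (Iₙ-single n) ⟫ ≈-cons (KR.*-identityˡ 1#) ≅-refl ≈-refl

  isModule : ∀ k l → IsModule R (_≈Gr_ {k} {l}) _+Gr_ 0Gr -Gr_ _·Gr_ (λ xs r → r ·Gr xs)
  isModule = isModuleGr

  act-cong : ∀ {k l} (σ : Permutation′ l) {x y : Gr k l} → x ≈Gr y → actGr σ x ≈Gr actGr σ y
  act-cong σ = ≈-hom (act-linear σ)

  act-+ : ∀ {k l} (σ : Permutation′ l) (x y : Gr k l) → actGr σ (x +Gr y) ≈Gr (actGr σ x +Gr actGr σ y)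
  act-+ σ = ++-hom (act-linear σ)

  act-· : ∀ {k l} (σ : Permutation′ l) r (x : Gr k l) → actGr σ (r ·Gr x) ≈Gr (r ·Gr actGr σ x)
  act-· σ r x = ≡⇒≈ (graphwise-· (σ ·G_) r x)

  act-ext : ∀ {k l} (σ σ' : Permutation′ l) (x : Gr k l) →
            (∀ i → σ ⟨$⟩ʳ i ≡ σ' ⟨$⟩ʳ i) → actGr σ x ≈Gr actGr σ' x
  act-ext σ σ' x h = graphwise-≅ (λ G → act-extG σ σ' G h) x

  act-id : ∀ {k l} (x : Gr k l) → actGr idₚ x ≈Gr x
  act-id x = graphwise-≅ act-idG x ⟫ ≡⇒≈ (termwise-id x)

  act-comp : ∀ {k l} (σ σ' : Permutation′ l) (x : Gr k l) →
             actGr (σ' ∘ₚ σ) x ≈Gr actGr σ (actGr σ' x)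
  act-comp σ σ' x = graphwise-≅ (act-compG σ σ') x ⟫ ≡⇒≈ (sym (graphwise-∘ (σ ·G_) (σ' ·G_) x))

  ract-cong : ∀ {k l} (τ : Permutation′ k) {x y : Gr k l} → x ≈Gr y → ractGr x τ ≈Gr ractGr y τ
  ract-cong τ = ≈-hom (ract-linear τ)

  ract-+ : ∀ {k l} (τ : Permutation′ k) (x y : Gr k l) → ractGr (x +Gr y) τ ≈Gr (ractGr x τ +Gr ractGr y τ)
  ract-+ τ = ++-hom (ract-linear τ)

  ract-· : ∀ {k l} (τ : Permutation′ k) r (x : Gr k l) → ractGr (r ·Gr x) τ ≈Gr (r ·Gr ractGr x τ)
  ract-· τ r x = ≡⇒≈ (graphwise-· (_G· τ) r x)

  ract-ext : ∀ {k l} (τ τ' : Permutation′ k) (x : Gr k l) →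
             (∀ i → τ ⟨$⟩ʳ i ≡ τ' ⟨$⟩ʳ i) → ractGr x τ ≈Gr ractGr x τ'
  ract-ext τ τ' x h = graphwise-≅ (λ G → ract-extG τ τ' G h) x

  ract-id : ∀ {k l} (x : Gr k l) → ractGr x idₚ ≈Gr x
  ract-id x = graphwise-≅ ract-idG x ⟫ ≡⇒≈ (termwise-id x)

  ract-comp : ∀ {k l} (τ τ' : Permutation′ k) (x : Gr k l) →
              ractGr x (τ' ∘ₚ τ) ≈Gr ractGr (ractGr x τ) τ'
  ract-comp τ τ' x = graphwise-≅ (ract-compG τ τ') x ⟫ ≡⇒≈ (sym (graphwise-∘ (_G· τ') (_G· τ) x))

  act-ract : ∀ {k l} (σ : Permutation′ l) (τ : Permutation′ k) (x : Gr k l) →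
             ractGr (actGr σ x) τ ≈Gr actGr σ (ractGr x τ)
  act-ract σ τ x = ≡⇒≈ (graphwise-∘ (_G· τ) (σ ·G_) x) ⟫ graphwise-≅ (act-ractG σ τ) x
                   ⟫ ≡⇒≈ (sym (graphwise-∘ (σ ·G_) (_G· τ) x))

  *-cong : ∀ {k l k' l'} {x x' : Gr k l} {y y' : Gr k' l'} →
           x ≈Gr x' → y ≈Gr y' → (x *Gr y) ≈Gr (x' *Gr y')
  *-cong {x' = x'} {y = y} p q = ≈-hom (*-linearˡ y) p ⟫ ≈-hom (*-linearʳ x') q

  *-+ˡ : ∀ {k l k' l'} (x x' : Gr k l) (y : Gr k' l') → ((x +Gr x') *Gr y) ≈Gr ((x *Gr y) +Gr (x' *Gr y))
  *-+ˡ x x' y = ++-hom (*-linearˡ y) x x'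

  *-+ʳ : ∀ {k l k' l'} (x : Gr k l) (y y' : Gr k' l') → (x *Gr (y +Gr y')) ≈Gr ((x *Gr y) +Gr (x *Gr y'))
  *-+ʳ x = ++-hom (*-linearʳ x)

  *-·ˡ : ∀ {k l k' l'} r (x : Gr k l) (y : Gr k' l') → ((r ·Gr x) *Gr y) ≈Gr (r ·Gr (x *Gr y))
  *-·ˡ = Horizontal.bil-·ˡ

  *-·ʳ : ∀ {k l k' l'} r (x : Gr k l) (y : Gr k' l') → (x *Gr (r ·Gr y)) ≈Gr (r ·Gr (x *Gr y))
  *-·ʳ = Horizontal.bil-·ʳ

  *-assoc : ∀ {k l k' l' k'' l''} (x : Gr k l) (y : Gr k' l') (z : Gr k'' l'') →
            subst₂ Gr (+-assoc k k' k'') (+-assoc l l' l'') ((x *Gr y) *Gr z) ≈Gr (x *Gr (y *Gr z))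
  *-assoc {k} {l} {k'} {l'} {k''} {l''} x y z =
    ≡⇒≈ (subst-graphwise e₁ e₂ ((x *Gr y) *Gr z))
    ⟫ ext₃ {Φ = λ x y z → termwise (λ a → a) (subst₂ Graph e₁ e₂) ((x *Gr y) *Gr z)}
           {Ψ = λ x y z → x *Gr (y *Gr z)}
      (λ y z → ∘-linear (∘-linear (*-linearˡ y) (*-linearˡ z)) (subst-linear e₁ e₂))
      (λ x z → ∘-linear (∘-linear (*-linearʳ x) (*-linearˡ z)) (subst-linear e₁ e₂))
      (λ x y → ∘-linear (*-linearʳ (x *Gr y)) (subst-linear e₁ e₂))
      (λ y z → *-linearˡ (y *Gr z))
      (λ x z → ∘-linear (*-linearˡ z) (*-linearʳ x))
      (λ x y → ∘-linear (*-linearʳ y) (*-linearʳ x))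
      (λ (a , G) (b , H) (d , J) → ≈-cons (KR.*-assoc a b d)
         (≅-trans (subst≅castG e₁ e₂ ((G *G H) *G J)) (*-assocG G H J)) ≈-refl)
      x y z
    where
    e₁ = +-assoc k k' k''
    e₂ = +-assoc l l' l''

  *-identityˡ : ∀ {k l} (x : Gr k l) → (I₀Gr *Gr x) ≈Gr x
  *-identityˡ = ext₁ (*-linearʳ I₀Gr) id-linear
    (λ (a , G) → ≈-cons (KR.*-identityˡ a) (*-identityˡG G) ≈-refl)

  *-identityʳ : ∀ {k l} (x : Gr k l) → subst₂ Gr (+-identityʳ k) (+-identityʳ l) (x *Gr I₀Gr) ≈Gr x
  *-identityʳ {k} {l} x =
    ≡⇒≈ (subst-graphwise e₁ e₂ (x *Gr I₀Gr))
    ⟫ ext₁ (∘-linear (*-linearˡ I₀Gr) (subst-linear e₁ e₂)) id-linear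
      (λ (a , G) → ≈-cons (KR.*-identityʳ a)
         (≅-trans (subst≅castG e₁ e₂ (G *G emptyGraph)) (*-identityʳG G)) ≈-refl) x
    where
    e₁ = +-identityʳ k
    e₂ = +-identityʳ l

  ∘-cong : ∀ {k l m} {x x' : Gr l m} {y y' : Gr k l} →
           x ≈Gr x' → y ≈Gr y' → (x ∘Gr y) ≈Gr (x' ∘Gr y')
  ∘-cong {x' = x'} {y = y} p q = ≈-hom (∘-linearˡ y) p ⟫ ≈-hom (∘-linearʳ x') q

  ∘-+ˡ : ∀ {k l m} (x x' : Gr l m) (y : Gr k l) → ((x +Gr x') ∘Gr y) ≈Gr ((x ∘Gr y) +Gr (x' ∘Gr y))
  ∘-+ˡ x x' y = ++-hom (∘-linearˡ y) x x'

  ∘-+ʳ : ∀ {k l m} (x : Gr l m) (y y' : Gr k l) → (x ∘Gr (y +Gr y')) ≈Gr ((x ∘Gr y) +Gr (x ∘Gr y'))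
  ∘-+ʳ x = ++-hom (∘-linearʳ x)

  ∘-·ˡ : ∀ {k l m} r (x : Gr l m) (y : Gr k l) → ((r ·Gr x) ∘Gr y) ≈Gr (r ·Gr (x ∘Gr y))
  ∘-·ˡ = Vertical.bil-·ˡ

  ∘-·ʳ : ∀ {k l m} r (x : Gr l m) (y : Gr k l) → (x ∘Gr (r ·Gr y)) ≈Gr (r ·Gr (x ∘Gr y))
  ∘-·ʳ = Vertical.bil-·ʳ

  ∘-assoc : ∀ {k l m n} (x : Gr m n) (y : Gr l m) (z : Gr k l) →
            ((x ∘Gr y) ∘Gr z) ≈Gr (x ∘Gr (y ∘Gr z))
  ∘-assoc = ext₃ {Φ = λ x y z → (x ∘Gr y) ∘Gr z} {Ψ = λ x y z → x ∘Gr (y ∘Gr z)}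
    (λ y z → ∘-linear (∘-linearˡ y) (∘-linearˡ z))
    (λ x z → ∘-linear (∘-linearʳ x) (∘-linearˡ z))
    (λ x y → ∘-linearʳ (x ∘Gr y))
    (λ y z → ∘-linearˡ (y ∘Gr z))
    (λ x z → ∘-linear (∘-linearˡ z) (∘-linearʳ x))
    (λ x y → ∘-linear (∘-linearʳ y) (∘-linearʳ x))
    (λ (a , C) (b , B) (d , A) → ≈-cons (KR.*-assoc a b d) (∘-assocG C B A) ≈-refl)

  ∘-identityʳ : ∀ {k l} (x : Gr k l) → (x ∘Gr Iₙ {P = Gr} _*Gr_ I₀Gr I₁Gr k) ≈Gr x
  ∘-identityʳ {k} x = ≈-hom (∘-linearʳ x) (Iₙ-single k)
    ⟫ ext₁ (∘-linearˡ [ (1# , idG k) ]) id-linear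
        (λ (a , H) → ≈-cons (KR.*-identityʳ a) (∘-wiringʳ H (idG k) (idG-wiring k)) ≈-refl) x

  ∘-identityˡ : ∀ {k l} (x : Gr k l) → (Iₙ {P = Gr} _*Gr_ I₀Gr I₁Gr l ∘Gr x) ≈Gr x
  ∘-identityˡ {l = l} x = ≈-hom (∘-linearˡ x) (Iₙ-single l)
    ⟫ ext₁ (∘-linearʳ [ (1# , idG l) ]) id-linear
        (λ (a , G) → ≈-cons (KR.*-identityˡ a) (∘-wiringˡ (idG l) G (idG-wiring l)) ≈-refl) x

  interchange : ∀ {k l m k' l' m'} (p : Gr l m) (p' : Gr l' m') (q : Gr k l) (q' : Gr k' l') →
                ((p *Gr p') ∘Gr (q *Gr q')) ≈Gr ((p ∘Gr q) *Gr (p' ∘Gr q'))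
  interchange = ext₄ {Φ = λ p p' q q' → (p *Gr p') ∘Gr (q *Gr q')}
                     {Ψ = λ p p' q q' → (p ∘Gr q) *Gr (p' ∘Gr q')}
    (λ p' q q' → ∘-linear (*-linearˡ p') (∘-linearˡ (q *Gr q')))
    (λ p q q' → ∘-linear (*-linearʳ p) (∘-linearˡ (q *Gr q')))
    (λ p p' q' → ∘-linear (*-linearˡ q') (∘-linearʳ (p *Gr p')))
    (λ p p' q → ∘-linear (*-linearʳ q) (∘-linearʳ (p *Gr p')))
    (λ p' q q' → ∘-linear (∘-linearˡ q) (*-linearˡ (p' ∘Gr q')))
    (λ p q q' → ∘-linear (∘-linearˡ q') (*-linearʳ (p ∘Gr q)))
    (λ p p' q' → ∘-linear (∘-linearʳ p) (*-linearˡ (p' ∘Gr q')))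
    (λ p p' q → ∘-linear (∘-linearʳ p') (*-linearʳ (p ∘Gr q)))
    (λ (a , H) (a' , H') (b , G) (b' , G') →
       ≈-cons (CommutativeSemigroupProperties.interchange KR.*-commutativeSemigroup a a' b b')
              (interchangeG H H' G G') ≈-refl)

  act-∘ : ∀ {k l m} (σ : Permutation′ m) (p : Gr l m) (q : Gr k l) →
          actGr σ (p ∘Gr q) ≈Gr (actGr σ p ∘Gr q)
  act-∘ σ = ext₂ {Φ = λ p q → actGr σ (p ∘Gr q)} {Ψ = λ p q → actGr σ p ∘Gr q}
    (λ q → ∘-linear (∘-linearˡ q) (act-linear σ)) (λ p → ∘-linear (∘-linearʳ p) (act-linear σ))
    (λ q → ∘-linear (act-linear σ) (∘-linearˡ q)) (λ p → ∘-linearʳ (actGr σ p))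
    (λ (a , H) (b , G) → ≈-cons KR.refl (act-∘G σ H G) ≈-refl)

  ract-∘ : ∀ {k l m} (ν : Permutation′ k) (p : Gr l m) (q : Gr k l) →
           ractGr (p ∘Gr q) ν ≈Gr (p ∘Gr ractGr q ν)
  ract-∘ ν = ext₂ {Φ = λ p q → ractGr (p ∘Gr q) ν} {Ψ = λ p q → p ∘Gr ractGr q ν}
    (λ q → ∘-linear (∘-linearˡ q) (ract-linear ν)) (λ p → ∘-linear (∘-linearʳ p) (ract-linear ν))
    (λ q → ∘-linearˡ (ractGr q ν)) (λ p → ∘-linear (ract-linear ν) (∘-linearʳ p))
    (λ (a , H) (b , G) → ≈-cons KR.refl (ract-∘G ν H G) ≈-refl)

  ract-act-∘ : ∀ {k l m} (τ : Permutation′ l) (p : Gr l m) (q : Gr k l) →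
               (ractGr p τ ∘Gr q) ≈Gr (p ∘Gr actGr τ q)
  ract-act-∘ τ = ext₂ {Φ = λ p q → ractGr p τ ∘Gr q} {Ψ = λ p q → p ∘Gr actGr τ q}
    (λ q → ∘-linear (ract-linear τ) (∘-linearˡ q)) (λ p → ∘-linearʳ (ractGr p τ))
    (λ q → ∘-linearˡ (actGr τ q)) (λ p → ∘-linear (act-linear τ) (∘-linearʳ p))
    (λ (a , H) (b , G) → ≈-cons KR.refl (ract-act-∘G τ H G) ≈-refl)

  act-* : ∀ {k l k' l'} (σ : Permutation′ l) (σ' : Permutation′ l') (p : Gr k l) (p' : Gr k' l') →
          (actGr σ p *Gr actGr σ' p') ≈Gr actGr (σ ⊗ₚ σ') (p *Gr p')
  act-* σ σ' = ext₂ {Φ = λ p p' → actGr σ p *Gr actGr σ' p'} {Ψ = λ p p' → actGr (σ ⊗ₚ σ') (p *Gr p')}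
    (λ p' → ∘-linear (act-linear σ) (*-linearˡ (actGr σ' p')))
    (λ p → ∘-linear (act-linear σ') (*-linearʳ (actGr σ p)))
    (λ p' → ∘-linear (*-linearˡ p') (act-linear (σ ⊗ₚ σ')))
    (λ p → ∘-linear (*-linearʳ p) (act-linear (σ ⊗ₚ σ')))
    (λ (a , G) (b , G') → ≈-cons KR.refl (act-*G σ σ' G G') ≈-refl)

  ract-* : ∀ {k l k' l'} (τ : Permutation′ k) (τ' : Permutation′ k') (p : Gr k l) (p' : Gr k' l') →
           (ractGr p τ *Gr ractGr p' τ') ≈Gr ractGr (p *Gr p') (τ ⊗ₚ τ')
  ract-* τ τ' = ext₂ {Φ = λ p p' → ractGr p τ *Gr ractGr p' τ'} {Ψ = λ p p' → ractGr (p *Gr p') (τ ⊗ₚ τ')}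
    (λ p' → ∘-linear (ract-linear τ) (*-linearˡ (ractGr p' τ')))
    (λ p → ∘-linear (ract-linear τ') (*-linearʳ (ractGr p τ)))
    (λ p' → ∘-linear (*-linearˡ p') (ract-linear (τ ⊗ₚ τ')))
    (λ p → ∘-linear (*-linearʳ p) (ract-linear (τ ⊗ₚ τ')))
    (λ (a , G) (b , G') → ≈-cons KR.refl (ract-*G τ τ' G G') ≈-refl)

  *-comm : ∀ {k l k' l'} (p : Gr k l) (p' : Gr k' l') →
           actGr (cperm l l') (p *Gr p') ≈Gr
           ractGr (subst₂ Gr (+-comm k' k) (+-comm l' l) (p' *Gr p)) (cperm k k')
  *-comm {k} {l} {k'} {l'} p p' =
    ext₂ {Φ = λ p p' → actGr (cperm l l') (p *Gr p')}
         {Ψ = λ p p' → ractGr (termwise (λ a → a) (subst₂ Graph e₁ e₂) (p' *Gr p)) (cperm k k')}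
      (λ p' → ∘-linear (*-linearˡ p') (act-linear (cperm l l')))
      (λ p → ∘-linear (*-linearʳ p) (act-linear (cperm l l')))
      (λ p' → ∘-linear (*-linearʳ p') (∘-linear (subst-linear e₁ e₂) (ract-linear (cperm k k'))))
      (λ p → ∘-linear (*-linearˡ p) (∘-linear (subst-linear e₁ e₂) (ract-linear (cperm k k'))))
      (λ (a , G) (b , G') → ≈-cons (KR.*-comm a b)
         (≅-trans (*-commG G G') (ract-congG (cperm k k') (castG≅subst e₁ e₂ (G' *G G)))) ≈-refl)
      p p'
    ⟫ ≡⇒≈ (cong (λ z → ractGr z (cperm k k')) (sym (subst-graphwise e₁ e₂ (p' *Gr p))))
    where
    e₁ = +-comm k' k
    e₂ = +-comm l' l

-- Each axiom is proved in 'ProPLaws' under the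
-- name of the corresponding field.
theorem1p18 : ∀ {c ℓ : Level} (K : Field c ℓ) →
    IsProP K (GraphProP.Gr K) (GraphProP._≈Gr_ K) (GraphProP._+Gr_ K)
      (GraphProP.0Gr K) (GraphProP.-Gr_ K) (GraphProP._·Gr_ K)
      (GraphProP.actGr K) (GraphProP.ractGr K)
      (GraphProP._*Gr_ K) (GraphProP._∘Gr_ K)
      (GraphProP.I₀Gr K) (GraphProP.I₁Gr K)
theorem1p18 K = record { ProPLaws K }
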